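{- Let $n$ and $\omega$ be positive integers with $n\left(1-\frac{1}{\lceil\sqrt{\omega}\rceil}-\frac{\lceil\sqrt{\omega}\rceil}{\omega}\right)\ge\lceil\sqrt{\omega}\rceil$. If $T$ is a reflexive tree of maximum degree at most $\frac{n}{\omega}$ and $\sigma$ is a voltage assignment on $T$ into $\mathbb{Z}_n$ that assigns to each loop a group element coprime to $n$, then $T^\sigma$ contains a cycle with at least $\left(1-\frac{1}{\lceil\sqrt{\omega}\rceil}-\frac{\lceil\sqrt{\omega}\rceil}{\omega}\right)|V(T^\sigma)|$ vertices.
   Context: A reflexive tree is a tree with exactly one loop at each vertex; its degree refers to the number of non-loop edges at a vertex. A voltage assignment is a map $\sigma$ from the arcs of $T$ (each edge $[u,v]$ gives arcs $(u,v),(v,u)$; each loop gives two arcs) to $\mathbb{Z}_n$ with $\sigma(v,u)=-\sigma(u,v)$ and the two loop arcs receiving opposite values. The lift $T^\sigma$ has vertex set $V(T)\times\mathbb{Z}_n$, with $(u,a)\sim(v,b)$ iff some arc $(u,v)$ has $\sigma(u,v)=b-a$. -}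

module Defs where

open import Data.Bool using (Bool; true; false; if_then_else_)
open import Data.Nat as ℕ using (ℕ; zero; suc; _≤_; _≤ᵇ_; NonZero)
open import Data.Nat.Properties using (≤-refl; ≤-trans; n≤1+n)
open import Data.Nat.Coprimality using (Coprime)
open import Data.Integer as ℤ using (ℤ; +_; ∣_∣)
open import Data.Integer.Divisibility using () renaming (_∣_ to _∣ℤ_)
open import Data.Fin using (Fin; toℕ)
open import Data.List using (List; []; _∷_; _++_; [_]; length; filterᵇ)
open import Data.List.Relation.Unary.Linked using (Linked)
open import Data.List.Relation.Unary.Unique.Propositional using (Unique)
open import Data.Product using (_×_; Σ; _,_)
open import Data.Sum using (_⊎_)
open import Data.Empty using (⊥)
open import Data.Fin.Base using () renaming (toℕ to finToℕ)
open import Data.List.Base using ()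
open import Data.Fin.Properties using ()
open import Relation.Nullary using (¬_)
open import Relation.Binary.PropositionalEquality using (_≡_)
import Data.List as L
open import Data.Rational as ℚ using (ℚ; 1ℚ; _/_)

ceilSqrtFrom : (fuel c ω : ℕ) → ℕ
ceilSqrtFrom zero     c ω = c
ceilSqrtFrom (suc f)  c ω = if ω ≤ᵇ c ℕ.* c then c else ceilSqrtFrom f (suc c) ω

ceilSqrt : ℕ → ℕ
ceilSqrt ω = ceilSqrtFrom ω 0 ω

ceilSqrtFrom-≥ : ∀ f c ω → c ≤ ceilSqrtFrom f c ω
ceilSqrtFrom-≥ zero c ω = ≤-refl
ceilSqrtFrom-≥ (suc f) c ω with ω ≤ᵇ c ℕ.* c
... | true  = ≤-refl
... | false = ≤-trans (n≤1+n c) (ceilSqrtFrom-≥ f (suc c) ω)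

ceilSqrt-nonZero : ∀ ω → .{{NonZero ω}} → NonZero (ceilSqrt ω)
ceilSqrt-nonZero (suc k) = ℕ.>-nonZero (ceilSqrtFrom-≥ k 1 (suc k))

ratio : (ω : ℕ) → .{{NonZero ω}} → ℚ
ratio ω = 1ℚ ℚ.- ((+ 1) / ceilSqrt ω) {{ceilSqrt-nonZero ω}} ℚ.- (+ ceilSqrt ω) / ω

data Walk {V : Set} (R : V → V → Set) : V → V → Set where
  []  : ∀ {x} → Walk R x x
  _∷_ : ∀ {x y z} → R x y → Walk R y z → Walk R x z

CyclicallyAdjacent : {V : Set} → (V → V → Set) → List V → Set
CyclicallyAdjacent R []       = ⊥
CyclicallyAdjacent R (v ∷ vs) = Linked R ((v ∷ vs) ++ [ v ])

record Cycle {V : Set} (R : V → V → Set) : Set where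
  field
    vertices : List V
    long     : 3 ≤ length vertices
    distinct : Unique vertices
    closed   : CyclicallyAdjacent R vertices

-- Reflexive trees.  Vertices are Fin size; E gives the non-loop edges
-- (a simple graph forming a tree); every vertex carries exactly one loop,
-- which is implicit (it is not part of E).

record ReflexiveTree : Set where
  field
    size      : ℕ
    nonempty  : NonZero size
    E         : Fin size → Fin size → Bool
    symmetric : ∀ u v → E u v ≡ E v u
    irreflex  : ∀ u → E u u ≡ false
    connected : ∀ u v → Walk (λ x y → E x y ≡ true) u v
    acyclic   : ¬ Cycle (λ x y → E x y ≡ true)

  degree : Fin size → ℕ
  degree u = length (filterᵇ (E u) (L.allFin size))

-- Voltage assignments into ℤ_n.  Elements of ℤ_n are represented by
-- integer representatives; equality in ℤ_n is congruence modulo n.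

_≡[mod_]_ : ℤ → ℕ → ℤ → Set
a ≡[mod n ] b = (+ n) ∣ℤ (a ℤ.- b)

record VoltageAssignment (T : ReflexiveTree) (n : ℕ) : Set where
  open ReflexiveTree T
  field
    -- value on the arc (u , v) of the non-loop edge [u , v]
    σ       : Fin size → Fin size → ℤ
    antisym : ∀ u v → E u v ≡ true → σ v u ≡[mod n ] (ℤ.- σ u v)
    -- value on one of the two arcs of the loop at u; the other arc
    -- of that loop receives the opposite value  - loopV u
    loopV   : Fin size → ℤ

LiftAdj : (T : ReflexiveTree) (n : ℕ) → VoltageAssignment T n →
          (Fin (ReflexiveTree.size T) × Fin n) →
          (Fin (ReflexiveTree.size T) × Fin n) → Set
LiftAdj T n vol (u , a) (v , b) =
    (E u v ≡ true × σ u v ≡[mod n ] (+ toℕ b ℤ.- + toℕ a))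
  ⊎ (u ≡ v × (loopV u ≡[mod n ] (+ toℕ b ℤ.- + toℕ a)
            ⊎ (ℤ.- loopV u) ≡[mod n ] (+ toℕ b ℤ.- + toℕ a)))
  where open ReflexiveTree T
        open VoltageAssignment vol

module Submission where

-- Take a spanning tree of T rooted at r and walk around the fibre of r in the lift using the loop at r.
-- Before each loop step at a vertex v of the tree, the walk may make a detour through the subtree of a
-- child w: up the edge vw, around most of the fibre of w (handling w's children in the same way), and
-- back down. Since the loop voltages are units, Dirichlet's approximation theorem in ℤₙ with c = ⌈√ω⌉
-- pigeonholes makes the detour miss at most n/c vertices of w's fibre and land at most c steps further
-- along v's fibre. With at most n/ω children per vertex, each fibre loses at most n/c + c n/ω vertices,
-- a fraction 1/c + c/ω of the lift, and the walk closes up into a cycle since the loop at r has order n.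

open import Data.Nat as ℕ using (ℕ; NonZero)
open import Data.Nat.Coprimality using (Coprime)
open import Data.Integer using (∣_∣)
open import Defs using (ReflexiveTree; VoltageAssignment)

module Lists where
  open import Data.Nat using (suc; _≤_; z≤n; s≤s)
  open import Data.List using (List; []; _∷_; _++_; [_]; length)
  open import Data.List.Membership.Propositional using (_∈_; _∉_)
  open import Data.List.Membership.Propositional.Properties using (∈-++⁺ˡ; ∈-++⁺ʳ)
  open import Data.List.Relation.Binary.Subset.Propositional using (_⊆_)
  open import Data.List.Relation.Unary.Any using (here; there)
  open import Data.List.Relation.Unary.All.Properties using (¬Any⇒All¬)
  open import Data.List.Relation.Unary.AllPairs using ([]; _∷_)
  open import Data.List.Relation.Unary.Linked using (Linked; [-]; _∷_)
  open import Data.List.Relation.Unary.Unique.Propositional using (Unique)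
  open import Data.List.Relation.Unary.Unique.Propositional.Properties
    using (Unique[x∷xs]⇒x∉xs)
  open import Data.Product using (Σ; _×_; _,_)
  open import Data.Empty using (⊥-elim)
  open import Relation.Binary.PropositionalEquality using (_≡_; _≢_; refl; cong; subst)
  open import Defs using (CyclicallyAdjacent)

  module _ {A : Set} where

    Unique-∷⁺ : ∀ {x : A} {xs} → x ∉ xs → Unique xs → Unique (x ∷ xs)
    Unique-∷⁺ x∉xs u = ¬Any⇒All¬ _ x∉xs ∷ u

    Unique-tail : ∀ {x : A} {xs} → Unique (x ∷ xs) → Unique xs
    Unique-tail (_ ∷ u) = u

    Unique-++⁻ˡ : ∀ (xs : List A) {ys} → Unique (xs ++ ys) → Unique xs
    Unique-++⁻ˡ []       _ = []
    Unique-++⁻ˡ (x ∷ xs) u =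
      Unique-∷⁺ (λ x∈xs → Unique[x∷xs]⇒x∉xs u (∈-++⁺ˡ x∈xs)) (Unique-++⁻ˡ xs (Unique-tail u))

    Unique-++⁻ʳ : ∀ (xs : List A) {ys} → Unique (xs ++ ys) → Unique ys
    Unique-++⁻ʳ []       u = u
    Unique-++⁻ʳ (x ∷ xs) u = Unique-++⁻ʳ xs (Unique-tail u)

    Unique-++⁻-disjoint : ∀ (xs : List A) {ys z} → Unique (xs ++ ys) → z ∈ xs → z ∉ ys
    Unique-++⁻-disjoint (x ∷ xs) u (here refl) z∈ys = Unique[x∷xs]⇒x∉xs u (∈-++⁺ʳ xs z∈ys)
    Unique-++⁻-disjoint (x ∷ xs) u (there z∈xs) = Unique-++⁻-disjoint xs (Unique-tail u) z∈xs

    private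
      remove : ∀ {x : A} {ys} → x ∈ ys →
               Σ (List A) λ zs → suc (length zs) ≡ length ys × (∀ {z} → z ∈ ys → z ≢ x → z ∈ zs)
      remove {ys = y ∷ ys} (here refl) =
        ys , refl , λ { (here refl) z≢x → ⊥-elim (z≢x refl) ; (there z∈ys) _ → z∈ys }
      remove {ys = y ∷ ys} (there x∈ys) with remove x∈ys
      ... | zs , len , sub =
        y ∷ zs , cong suc len , λ { (here refl) _ → here refl ; (there z∈ys) z≢x → there (sub z∈ys z≢x) }

    Unique-⊆⇒length-≤ : ∀ {xs ys : List A} → Unique xs → xs ⊆ ys → length xs ≤ length ys
    Unique-⊆⇒length-≤ {[]}     _ _   = z≤n
    Unique-⊆⇒length-≤ {x ∷ xs} u xs⊆ys with remove (xs⊆ys (here refl))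
    ... | zs , len , sub = subst (suc (length xs) ≤_) len (s≤s (Unique-⊆⇒length-≤ (Unique-tail u)
            λ z∈xs → sub (xs⊆ys (there z∈xs)) λ { refl → Unique[x∷xs]⇒x∉xs u z∈xs }))

    data Chain (R : A → A → Set) : A → List A → A → Set where
      ⟨_⟩ : ∀ a → Chain R a [ a ] a
      _∷_ : ∀ {a b xs c} → R a b → Chain R b xs c → Chain R a (a ∷ xs) c

    Chain-++ : ∀ {R a xs b c ys d} → Chain R a xs b → R b c → Chain R c ys d → Chain R a (xs ++ ys) d
    Chain-++ ⟨ _ ⟩      r q = r ∷ q
    Chain-++ (r′ ∷ p) r q = r′ ∷ Chain-++ p r q

    Chain⇒Linked : ∀ {R a xs b} → Chain R a xs b → Linked R xs
    Chain⇒Linked ⟨ _ ⟩          = [-]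
    Chain⇒Linked (r ∷ ⟨ _ ⟩)    = r ∷ [-]
    Chain⇒Linked (r ∷ (r′ ∷ p)) = r ∷ Chain⇒Linked (r′ ∷ p)

    Chain⇒CyclicallyAdjacent : ∀ {R a xs b} → Chain R a xs b → R b a → CyclicallyAdjacent R xs
    Chain⇒CyclicallyAdjacent ⟨ _ ⟩    r = r ∷ [-]
    Chain⇒CyclicallyAdjacent (r′ ∷ p) r = Chain⇒Linked (Chain-++ (r′ ∷ p) r ⟨ _ ⟩)

module Congruence (n : ℕ) .{{_ : NonZero n}} where

  open import Data.Nat as ℕ using (ℕ; zero; suc; _<_; NonZero)
  import Data.Nat.Properties as ℕ
  import Data.Nat.Divisibility as ℕ
  open import Data.Nat.Coprimality using (Coprime; coprime-divisor; coprime-Bézout)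
  import Data.Nat.Coprimality as Coprime
  open import Data.Nat.GCD using (module Bézout)
  open import Data.Integer using (ℤ; +_; -[1+_]; ∣_∣; _+_; _-_; -_; _*_)
  import Data.Integer.Properties as ℤ
  open import Data.Integer.DivMod using (_%ℕ_; _/ℕ_; n%ℕd<d; a≡a%ℕn+[a/ℕn]*n)
  open import Data.Integer.Divisibility.Signed using (_∣_; divides; ∣⇒∣ᵤ; ∣ᵤ⇒∣; ∣m⇒∣-m; ∣m∣n⇒∣m+n; ∣m⇒∣m*n)
  open import Data.Integer.Tactic.RingSolver using (solve-∀)
  open import Data.Fin using (Fin; toℕ; fromℕ<)
  import Data.Fin.Properties as Fin
  open import Data.Product using (Σ; _,_)
  open import Data.Sum using (inj₁; inj₂)
  open import Data.Empty using (⊥-elim)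
  open import Relation.Binary.PropositionalEquality using (_≡_; refl; sym; trans; cong; subst; module ≡-Reasoning)
  open import Defs using (_≡[mod_]_)

  infix 4 _≈_

  -- A record, unlike a bare divisibility statement, lets Agda infer a and b.
  record _≈_ (a b : ℤ) : Set where
    constructor ⟦_⟧
    field ∣-diff : + n ∣ a - b

  ≈⇒≡[mod] : ∀ {a b} → a ≈ b → a ≡[mod n ] b
  ≈⇒≡[mod] ⟦ d ⟧ = ∣⇒∣ᵤ d

  ≡[mod]⇒≈ : ∀ {a b} → a ≡[mod n ] b → a ≈ b
  ≡[mod]⇒≈ d = ⟦ ∣ᵤ⇒∣ d ⟧

  ≈-reflexive : ∀ {a b} → a ≡ b → a ≈ b
  ≈-reflexive {a} refl = ⟦ divides (+ 0) (ℤ.+-inverseʳ a) ⟧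

  ≈-sym : ∀ {a b} → a ≈ b → b ≈ a
  ≈-sym {a} {b} ⟦ d ⟧ = ⟦ subst (+ n ∣_) (lemma a b) (∣m⇒∣-m d) ⟧
    where lemma : ∀ a b → - (a - b) ≡ b - a
          lemma = solve-∀

  ≈-trans : ∀ {a b c} → a ≈ b → b ≈ c → a ≈ c
  ≈-trans {a} {b} {c} ⟦ d ⟧ ⟦ e ⟧ = ⟦ subst (+ n ∣_) (lemma a b c) (∣m∣n⇒∣m+n d e) ⟧
    where lemma : ∀ a b c → (a - b) + (b - c) ≡ a - c
          lemma = solve-∀

  ≈-subst : ∀ {a b a′ b′} → a ≡ a′ → b ≡ b′ → a ≈ b → a′ ≈ b′
  ≈-subst refl refl a≈b = a≈b

  +-cong : ∀ {a b p q} → a ≈ b → p ≈ q → a + p ≈ b + q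
  +-cong {a} {b} {p} {q} ⟦ d ⟧ ⟦ e ⟧ = ⟦ subst (+ n ∣_) (lemma a b p q) (∣m∣n⇒∣m+n d e) ⟧
    where lemma : ∀ a b p q → (a - b) + (p - q) ≡ (a + p) - (b + q)
          lemma = solve-∀

  -‿cong : ∀ {a b} → a ≈ b → - a ≈ - b
  -‿cong {a} {b} ⟦ d ⟧ = ⟦ subst (+ n ∣_) (lemma a b) (∣m⇒∣-m d) ⟧
    where lemma : ∀ a b → - (a - b) ≡ (- a) - (- b)
          lemma = solve-∀

  *-congʳ : ∀ {a b} k → a ≈ b → a * k ≈ b * k
  *-congʳ {a} {b} k ⟦ d ⟧ = ⟦ subst (+ n ∣_) (lemma a b k) (∣m⇒∣m*n k d) ⟧
    where lemma : ∀ a b k → (a - b) * k ≡ a * k - b * k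
          lemma = solve-∀

  +-multiple : ∀ x k → x + k * + n ≈ x
  +-multiple x k = ⟦ divides k (lemma x k (+ n)) ⟧
    where lemma : ∀ x k n → (x + k * n) - x ≡ k * n
          lemma = solve-∀

  reduce : ℤ → Fin n
  reduce x = fromℕ< (n%ℕd<d x n)

  ≈-reduce : ∀ x → x ≈ + toℕ (reduce x)
  ≈-reduce x rewrite Fin.toℕ-fromℕ< (n%ℕd<d x n) =
    subst (_≈ + (x %ℕ n)) (sym (a≡a%ℕn+[a/ℕn]*n x n)) (+-multiple (+ (x %ℕ n)) (x /ℕ n))

  private
    ∣-∣<n : ∀ a b → a < n → b < n → ∣ + a - + b ∣ < n
    ∣-∣<n a b a<n b<n rewrite ℤ.m-n≡m⊖n a b with ℕ.≤-total a b
    ... | inj₁ a≤b rewrite ℤ.∣⊖∣-≤ a≤b = ℕ.≤-<-trans (ℕ.m∸n≤m b a) b<n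
    ... | inj₂ b≤a rewrite ℤ.∣m⊖n∣≡∣n⊖m∣ a b | ℤ.∣⊖∣-≤ b≤a = ℕ.≤-<-trans (ℕ.m∸n≤m a b) a<n

    ≈-residues : ∀ a b → a < n → b < n → + a ≈ + b → a ≡ b
    ≈-residues a b a<n b<n ⟦ d ⟧ with ∣ + a - + b ∣ in eq | ∣-∣<n a b a<n b<n | ∣⇒∣ᵤ d
    ... | zero  | _   | _   = ℤ.+-injective (ℤ.i-j≡0⇒i≡j (+ a) (+ b) (ℤ.∣i∣≡0⇒i≡0 eq))
    ... | suc _ | d<n | n∣d = ⊥-elim (ℕ.<⇒≱ d<n (ℕ.∣⇒≤ n∣d))

  reduce-cong : ∀ {a b} → a ≈ b → reduce a ≡ reduce b
  reduce-cong {a} {b} a≈b = Fin.toℕ-injective (≈-residues _ _ (Fin.toℕ<n (reduce a)) (Fin.toℕ<n (reduce b))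
    (≈-trans (≈-sym (≈-reduce a)) (≈-trans a≈b (≈-reduce b))))

  reduce-injective : ∀ {a b} → reduce a ≡ reduce b → a ≈ b
  reduce-injective {a} {b} eq =
    ≈-trans (≈-reduce a) (subst (λ r → + toℕ r ≈ b) (sym eq) (≈-sym (≈-reduce b)))

  reduce-difference : ∀ x y → + toℕ (reduce y) - + toℕ (reduce x) ≈ y - x
  reduce-difference x y = +-cong (≈-sym (≈-reduce y)) (-‿cong (≈-sym (≈-reduce x)))

  unit-annihilator : ∀ h k → Coprime ∣ h ∣ n → + k * h ≈ + 0 → n ℕ.∣ k
  unit-annihilator h k cop ⟦ d ⟧ = coprime-divisor (Coprime.sym cop) (subst (n ℕ.∣_) eq (∣⇒∣ᵤ d))
    where eq : ∣ + k * h - + 0 ∣ ≡ ∣ h ∣ ℕ.* k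
          eq rewrite ℤ.+-identityʳ (+ k * h) | ℤ.abs-* (+ k) h = ℕ.*-comm k ∣ h ∣

  private
    inverseℕ : ∀ k → Coprime k n → Σ ℤ λ u → u * + k ≈ + 1
    inverseℕ k cop with coprime-Bézout cop
    ... | Bézout.+- x y eq = + x , ≈-subst e refl (+-multiple (+ 1) (+ y))
      where e : + 1 + + y * + n ≡ + x * + k
            e = trans (cong (_+_ (+ 1)) (sym (ℤ.pos-* y n))) (trans (cong +_ eq) (ℤ.pos-* x k))
    ... | Bézout.-+ x y eq = - + x , ≈-subst e refl (+-multiple (+ 1) (- + y))
      where
        1+xk≡yn : + 1 + + x * + k ≡ + y * + n
        1+xk≡yn = trans (cong (_+_ (+ 1)) (sym (ℤ.pos-* x k))) (trans (cong +_ eq) (ℤ.pos-* y n))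
        e : + 1 + - + y * + n ≡ - + x * + k
        e = begin
          + 1 + - + y * + n       ≡⟨ l₁ (+ y) (+ n) ⟩
          + 1 - + y * + n         ≡⟨ cong (_-_ (+ 1)) (sym 1+xk≡yn) ⟩
          + 1 - (+ 1 + + x * + k) ≡⟨ l₂ (+ x) (+ k) ⟩
          - + x * + k             ∎
          where
            open ≡-Reasoning
            l₁ : ∀ y n → + 1 + - y * n ≡ + 1 - y * n
            l₁ = solve-∀
            l₂ : ∀ x k → + 1 - (+ 1 + x * k) ≡ - x * k
            l₂ = solve-∀

  inverse : ∀ g → Coprime ∣ g ∣ n → Σ ℤ λ u → u * g ≈ + 1
  inverse (+ k)      cop = inverseℕ k cop
  inverse -[1+ k ] cop with inverseℕ (suc k) cop
  ... | u , u*k≈1 = - u , ≈-subst (lemma u (+ suc k)) refl u*k≈1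
    where lemma : ∀ u k → u * k ≡ (- u) * (- k)
          lemma = solve-∀

module Dirichlet (n : ℕ) .{{_ : NonZero n}} where

  open import Data.Nat as ℕ using (ℕ; suc; _≤_; _<_; _∸_; NonZero)
  import Data.Nat.Properties as ℕ
  import Data.Nat.Divisibility as ℕ
  open import Data.Nat.DivMod using (_/_; _%_; m≡m%n+[m/n]*n; m%n<n; m<n*o⇒m/o<n)
  open import Data.Nat.Coprimality using (Coprime)
  open import Data.Bool using (Bool; true; false; not)
  open import Data.Integer using (ℤ; +_; ∣_∣; _+_; _-_; -_; _*_)
  import Data.Integer.Properties as ℤ
  open import Data.Integer.Tactic.RingSolver using (solve-∀)
  open import Data.Fin using (Fin; toℕ; fromℕ<)
  import Data.Fin.Properties as Fin
  open import Data.Product using (Σ; _×_; _,_; proj₁; proj₂)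
  open import Data.Sum using (_⊎_; inj₁; inj₂)
  open import Relation.Nullary using (¬_)
  open import Relation.Binary.PropositionalEquality using (_≡_; refl; sym; trans; cong; cong₂; subst; module ≡-Reasoning)
  open Congruence n

  signed : Bool → ℤ → ℤ
  signed true  g = g
  signed false g = - g

  signed-not : ∀ s g → signed (not s) g ≡ - signed s g
  signed-not true  g = refl
  signed-not false g = sym (ℤ.neg-involutive g)

  signed-*ʳ : ∀ s a b → signed s a * b ≡ a * signed s b
  signed-*ʳ true  a b = refl
  signed-*ʳ false a b = lemma a b
    where lemma : ∀ a b → - a * b ≡ a * - b
          lemma = solve-∀

  +-∸ : ∀ {m k} → k ≤ m → + (m ∸ k) ≡ + m - + k
  +-∸ {m} {k} k≤m = sym (trans (ℤ.m-n≡m⊖n m k) (ℤ.⊖-≥ k≤m))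

  same-quotient⇒∸< : ∀ a b d .{{_ : NonZero d}} → a / d ≡ b / d → a ≤ b → b ∸ a < d
  same-quotient⇒∸< a b d eq a≤b =
    ℕ.≤-<-trans (subst (_≤ b % d) (sym b∸a≡) (ℕ.m∸n≤m (b % d) (a % d))) (m%n<n b d)
    where
      open ≡-Reasoning
      q : ℕ
      q = b / d ℕ.* d
      b∸a≡ : b ∸ a ≡ b % d ∸ a % d
      b∸a≡ = begin
        b ∸ a                                     ≡⟨ cong₂ _∸_ (m≡m%n+[m/n]*n b d) (m≡m%n+[m/n]*n a d) ⟩
        (b % d ℕ.+ q) ∸ (a % d ℕ.+ a / d ℕ.* d)   ≡⟨ cong (λ k → (b % d ℕ.+ q) ∸ (a % d ℕ.+ k ℕ.* d)) eq ⟩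
        (b % d ℕ.+ q) ∸ (a % d ℕ.+ q)             ≡⟨ cong₂ _∸_ (ℕ.+-comm (b % d) q) (ℕ.+-comm (a % d) q) ⟩
        (q ℕ.+ b % d) ∸ (q ℕ.+ a % d)             ≡⟨ ℕ.[m+n]∸[m+o]≡n∸o q (b % d) (a % d) ⟩
        b % d ∸ a % d                             ∎

  -- Dirichlet's approximation theorem in ℤₙ: among 0, α, …, cα two residues lie in the same of the c
  -- intervals [kn/c, (k+1)n/c), so some jα with 1 ≤ j ≤ c is within n/c of 0.
  small-multiple : ∀ c → 1 ≤ c → (α : ℤ) →
                   Σ ℕ λ j → Σ ℕ λ t → Σ Bool λ s → 1 ≤ j × j ≤ c × t ℕ.* c < n × signed s (+ t) ≈ + j * α
  small-multiple c 1≤c α = conclude (ℕ.≤-total A B)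
    where
      instance
        c≢0 : NonZero c
        c≢0 = ℕ.>-nonZero 1≤c
      residue : Fin (suc c) → ℕ
      residue i = toℕ (reduce (+ toℕ i * α))
      bucket<c : ∀ i → residue i ℕ.* c / n < c
      bucket<c i = m<n*o⇒m/o<n
        (subst (residue i ℕ.* c <_) (ℕ.*-comm n c) (ℕ.*-monoˡ-< c (Fin.toℕ<n (reduce (+ toℕ i * α)))))
      collision : Σ (Fin (suc c)) λ i → Σ (Fin (suc c)) λ i′ →
                  toℕ i < toℕ i′ × fromℕ< (bucket<c i) ≡ fromℕ< (bucket<c i′)
      collision = Fin.pigeonhole (ℕ.n<1+n c) (λ i → fromℕ< (bucket<c i))
      i i′ : Fin (suc c)
      i  = proj₁ collision
      i′ = proj₁ (proj₂ collision)
      i<i′ : toℕ i < toℕ i′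
      i<i′ = proj₁ (proj₂ (proj₂ collision))
      A B : ℕ
      A = residue i
      B = residue i′
      same-bucket : A ℕ.* c / n ≡ B ℕ.* c / n
      same-bucket = Fin.fromℕ<-injective _ _ (bucket<c i) (bucket<c i′) (proj₂ (proj₂ (proj₂ collision)))
      j : ℕ
      j = toℕ i′ ∸ toℕ i
      B-A≈jα : + B - + A ≈ + j * α
      B-A≈jα = ≈-subst refl (trans (lemma (+ toℕ i′) (+ toℕ i) α) (cong (_* α) (sym (+-∸ (ℕ.<⇒≤ i<i′)))))
                 (reduce-difference (+ toℕ i * α) (+ toℕ i′ * α))
        where lemma : ∀ a b x → a * x - b * x ≡ (a - b) * x
              lemma = solve-∀
      close : ∀ {a b} → a ≤ b → a ℕ.* c / n ≡ b ℕ.* c / n → (b ∸ a) ℕ.* c < n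
      close {a} {b} a≤b eq =
        subst (_< n) (sym (ℕ.*-distribʳ-∸ c b a)) (same-quotient⇒∸< _ _ n eq (ℕ.*-monoˡ-≤ c a≤b))
      1≤j : 1 ≤ j
      1≤j = ℕ.m<n⇒0<n∸m i<i′
      j≤c : j ≤ c
      j≤c = ℕ.≤-trans (ℕ.m∸n≤m (toℕ i′) (toℕ i)) (ℕ.≤-pred (Fin.toℕ<n i′))
      conclude : A ≤ B ⊎ B ≤ A → Σ ℕ λ j → Σ ℕ λ t → Σ Bool λ s →
                 1 ≤ j × j ≤ c × t ℕ.* c < n × signed s (+ t) ≈ + j * α
      conclude (inj₁ A≤B) = j , B ∸ A , true , 1≤j , j≤c , close A≤B same-bucket ,
                            ≈-subst (sym (+-∸ A≤B)) refl B-A≈jα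
      conclude (inj₂ B≤A) = j , A ∸ B , false , 1≤j , j≤c , close B≤A (sym same-bucket) ,
                            ≈-subst (trans (lemma (+ A) (+ B)) (cong -_ (sym (+-∸ B≤A)))) refl B-A≈jα
        where lemma : ∀ a b → b - a ≡ - (a - b)
              lemma = solve-∀

  record Detour (c : ℕ) (h g : ℤ) : Set where
    field
      offset     : ℕ
      steps      : ℕ
      sign       : Bool
      1≤offset   : 1 ≤ offset
      offset≤c   : offset ≤ c
      steps<n    : steps < n
      few-missed : c ℕ.* (n ∸ steps) ≤ n
      closes     : + steps * signed sign g ≈ + offset * h

  multiple-of-unit≉0 : ∀ {j c h} → 1 ≤ j → j ≤ c → c < n → Coprime ∣ h ∣ n → ¬ (+ j * h ≈ + 0)
  multiple-of-unit≉0 {j} {h = h} 1≤j j≤c c<n cop jh≈0 =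
    ℕ.<⇒≱ (ℕ.≤-<-trans j≤c c<n) (ℕ.∣⇒≤ {{ℕ.>-nonZero 1≤j}} (unit-annihilator h j cop jh≈0))

  -- With α = h g⁻¹ and jα ≈ ±t small, n − t steps of ∓g add up to ±t g ≈ j h.
  detour : ∀ c h g → 1 ≤ c → c < n → Coprime ∣ h ∣ n → Coprime ∣ g ∣ n → Detour c h g
  detour c h g 1≤c c<n cop-h cop-g with inverse g cop-g
  ... | u , ug≈1 with small-multiple c 1≤c (h * u)
  ... | j , t , s , 1≤j , j≤c , tc<n , ±t≈jα = record
    { offset     = j
    ; steps      = n ∸ t
    ; sign       = not s
    ; 1≤offset   = 1≤j
    ; offset≤c   = j≤c
    ; steps<n    = ℕ.∸-monoʳ-< 1≤t t≤n
    ; few-missed = subst (λ m → c ℕ.* m ≤ n) (sym (ℕ.m∸[m∸n]≡n t≤n))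
                     (ℕ.<⇒≤ (subst (_< n) (ℕ.*-comm t c) tc<n))
    ; closes     = ≈-trans (≈-subst (sym wrap-around) refl (+-multiple (+ t * signed s g) (signed (not s) g))) tg≈jh
    }
    where
      instance
        c≢0 : NonZero c
        c≢0 = ℕ.>-nonZero 1≤c
      t≤n : t ≤ n
      t≤n = ℕ.<⇒≤ (ℕ.≤-<-trans (ℕ.m≤m*n t c) tc<n)
      tg≈jh : + t * signed s g ≈ + j * h
      tg≈jh = ≈-subst (signed-*ʳ s (+ t) g) refl (≈-trans (*-congʳ g ±t≈jα)
                (≈-subst (lemma (+ j) h u g) (ℤ.*-identityˡ (+ j * h)) (*-congʳ (+ j * h) ug≈1)))
        where lemma : ∀ j h u g → u * g * (j * h) ≡ j * (h * u) * g
              lemma = solve-∀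
      1≤t : 1 ≤ t
      1≤t = ℕ.n≢0⇒n>0 λ { refl →
        multiple-of-unit≉0 1≤j j≤c c<n cop-h (≈-sym (≈-subst (ℤ.*-zeroˡ (signed s g)) refl tg≈jh)) }
      wrap-around : + (n ∸ t) * signed (not s) g ≡ + t * signed s g + signed (not s) g * + n
      wrap-around = begin
        + (n ∸ t) * signed (not s) g          ≡⟨ cong₂ _*_ (+-∸ t≤n) (signed-not s g) ⟩
        (+ n - + t) * - signed s g            ≡⟨ lemma (+ n) (+ t) (signed s g) ⟩
        + t * signed s g + - signed s g * + n ≡⟨ cong (λ x → + t * signed s g + x * + n) (sym (signed-not s g)) ⟩
        + t * signed s g + signed (not s) g * + n ∎
        where
          open ≡-Reasoning
          lemma : ∀ n t g → (n - t) * - g ≡ t * g + - g * n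
          lemma = solve-∀

module SpanningTree (T : ReflexiveTree) where

  open ReflexiveTree T

  open import Defs using (Walk; []; _∷_)

  open import Data.Nat as ℕ using (ℕ; zero; suc; _≤_; _<_; _+_)
  import Data.Nat.Properties as ℕ
  open import Data.Bool using (true) renaming (T to True)
  open import Data.Bool.Properties using (T?)
  open import Function using (_∘_)
  open import Data.Unit using (tt)
  open import Data.Fin using (Fin; _≟_)
  import Data.Fin.Properties as Fin
  open import Data.List using (List; []; _∷_; _++_; [_]; length; filterᵇ; allFin)
  open import Data.List.Properties using (length-tabulate)
  open import Data.List.Membership.Propositional using (_∈_; _∉_)
  open import Data.List.Membership.Propositional.Properties using (∈-++⁺ˡ; ∈-++⁺ʳ; ∈-++⁻; ∈-allFin; ∈-filter⁺)
  open import Data.List.Membership.DecPropositional (_≟_ {size}) using (_∈?_)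
  open import Data.List.Relation.Unary.Any using (here; there)
  open import Data.List.Relation.Unary.Unique.Propositional using (Unique)
  open import Data.List.Relation.Unary.AllPairs using ([])
  open import Data.List.Relation.Unary.Unique.Propositional.Properties using (++⁺; allFin⁺)
  open import Data.Product using (Σ; _×_; _,_)
  open import Data.Sum using (_⊎_; inj₁; inj₂)
  import Data.Sum as Sum
  import Data.Product as Product
  open import Data.Empty using (⊥-elim)
  open import Relation.Nullary using (¬_; yes; no)
  open import Relation.Binary.PropositionalEquality using (_≡_; refl; sym; subst)
  open Lists

  Adj : Fin size → Fin size → Set
  Adj u v = E u v ≡ true

  -- Left-child right-sibling encoding: branch e t u is u with t hung below its root as an extra child.
  data RootedTree : Fin size → Set where
    leaf   : ∀ {v} → RootedTree v
    branch : ∀ {v w} → Adj v w → RootedTree w → RootedTree v → RootedTree v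

  vertices : ∀ {v} → RootedTree v → List (Fin size)
  vertices {v} leaf       = [ v ]
  vertices (branch _ t u) = vertices t ++ vertices u

  childRoots : ∀ {v} → RootedTree v → List (Fin size)
  childRoots leaf                   = []
  childRoots (branch {w = w} _ _ u) = w ∷ childRoots u

  root∈vertices : ∀ {v} (t : RootedTree v) → v ∈ vertices t
  root∈vertices leaf           = here refl
  root∈vertices (branch _ t u) = ∈-++⁺ʳ (vertices t) (root∈vertices u)

  childRoots⊆vertices : ∀ {v} (t : RootedTree v) {w} → w ∈ childRoots t → w ∈ vertices t
  childRoots⊆vertices (branch _ t u) (here refl) = ∈-++⁺ˡ (root∈vertices t)
  childRoots⊆vertices (branch _ t u) (there w∈) = ∈-++⁺ʳ (vertices t) (childRoots⊆vertices u w∈)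

  Unique-childRoots : ∀ {v} (t : RootedTree v) → Unique (vertices t) → Unique (childRoots t)
  Unique-childRoots leaf           _ = []
  Unique-childRoots (branch _ t u) uniq =
    Unique-∷⁺ (λ w∈ → Unique-++⁻-disjoint (vertices t) uniq (root∈vertices t) (childRoots⊆vertices u w∈))
              (Unique-childRoots u (Unique-++⁻ʳ (vertices t) uniq))

  childRoots-neighbours : ∀ {v} (t : RootedTree v) {w} → w ∈ childRoots t → w ∈ filterᵇ (E v) (allFin size)
  childRoots-neighbours (branch e _ _) (here refl) = ∈-filter⁺ (T? ∘ E _) (∈-allFin _) (subst True (sym e) tt)
  childRoots-neighbours (branch _ _ u) (there w∈)  = childRoots-neighbours u w∈

  #children : ∀ {v} → RootedTree v → ℕ
  #children t = length (childRoots t)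

  #children≤degree : ∀ {v} (t : RootedTree v) → Unique (vertices t) → #children t ≤ degree v
  #children≤degree t uniq = Unique-⊆⇒length-≤ (Unique-childRoots t uniq) (childRoots-neighbours t)

  attach : ∀ {x y v} → Adj x y → RootedTree v → RootedTree v
  attach {x} e (leaf {v}) with v ≟ x
  ... | yes refl = branch e leaf leaf
  ... | no  _ = leaf
  attach e (branch e′ t u) = branch e′ (attach e t) (attach e u)

  module _ {x y} (e : Adj x y) where

    ∈-attach⁺ : ∀ {v z} (t : RootedTree v) → z ∈ vertices t → z ∈ vertices (attach e t)
    ∈-attach⁺ (leaf {v}) z∈ with v ≟ x
    ... | yes refl = there z∈
    ... | no  _ = z∈
    ∈-attach⁺ (branch _ t u) z∈ with ∈-++⁻ (vertices t) z∈
    ... | inj₁ z∈t = ∈-++⁺ˡ (∈-attach⁺ t z∈t)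
    ... | inj₂ z∈u = ∈-++⁺ʳ (vertices (attach e t)) (∈-attach⁺ u z∈u)

    ∈-attach-new : ∀ {v} (t : RootedTree v) → x ∈ vertices t → y ∈ vertices (attach e t)
    ∈-attach-new (leaf {v}) (here v≡x) with v ≟ x
    ... | yes refl = here refl
    ... | no v≢x = ⊥-elim (v≢x (sym v≡x))
    ∈-attach-new (branch _ t u) x∈ with ∈-++⁻ (vertices t) x∈
    ... | inj₁ x∈t = ∈-++⁺ˡ (∈-attach-new t x∈t)
    ... | inj₂ x∈u = ∈-++⁺ʳ (vertices (attach e t)) (∈-attach-new u x∈u)

    ∈-attach⁻ : ∀ {v z} (t : RootedTree v) → z ∈ vertices (attach e t) → z ∈ vertices t ⊎ (z ≡ y × x ∈ vertices t)
    ∈-attach⁻ (leaf {v}) z∈ with v ≟ x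
    ∈-attach⁻ leaf (here z≡y) | yes refl = inj₂ (z≡y , here refl)
    ∈-attach⁻ leaf (there z∈) | yes refl = inj₁ z∈
    ∈-attach⁻ leaf z∈         | no  _    = inj₁ z∈
    ∈-attach⁻ (branch _ t u) z∈ with ∈-++⁻ (vertices (attach e t)) z∈
    ... | inj₁ z∈t = Sum.map ∈-++⁺ˡ (Product.map₂ ∈-++⁺ˡ) (∈-attach⁻ t z∈t)
    ... | inj₂ z∈u = Sum.map (∈-++⁺ʳ (vertices t)) (Product.map₂ (∈-++⁺ʳ (vertices t))) (∈-attach⁻ u z∈u)

    Unique-attach : ∀ {v} (t : RootedTree v) → y ∉ vertices t → Unique (vertices t) → Unique (vertices (attach e t))
    Unique-attach (leaf {v}) y∉ uniq with v ≟ x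
    ... | yes refl = Unique-∷⁺ (λ { (here refl) → y∉ (here refl) }) uniq
    ... | no  _ = uniq
    Unique-attach (branch _ t u) y∉ uniq = ++⁺
      (Unique-attach t (y∉ ∘ ∈-++⁺ˡ) (Unique-++⁻ˡ (vertices t) uniq))
      (Unique-attach u (y∉ ∘ ∈-++⁺ʳ (vertices t)) (Unique-++⁻ʳ (vertices t) uniq))
      disjoint
      where
        disjoint : ∀ {z} → ¬ (z ∈ vertices (attach e t) × z ∈ vertices (attach e u))
        disjoint (z∈t , z∈u) with ∈-attach⁻ t z∈t | ∈-attach⁻ u z∈u
        ... | inj₁ z∈t′          | inj₁ z∈u′          = Unique-++⁻-disjoint (vertices t) uniq z∈t′ z∈u′
        ... | inj₁ z∈t′          | inj₂ (refl , _)    = y∉ (∈-++⁺ˡ z∈t′)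
        ... | inj₂ (refl , _)    | inj₁ z∈u′          = y∉ (∈-++⁺ʳ (vertices t) z∈u′)
        ... | inj₂ (_ , x∈t)     | inj₂ (_ , x∈u)     = Unique-++⁻-disjoint (vertices t) uniq x∈t x∈u

  crossing-edge : ∀ (S : List (Fin size)) {a b} → Walk Adj a b → a ∈ S → b ∉ S →
                  Σ (Fin size) λ x → Σ (Fin size) λ y → x ∈ S × y ∉ S × Adj x y
  crossing-edge S []                   a∈S b∉S = ⊥-elim (b∉S a∈S)
  crossing-edge S {a} (_∷_ {y = a′} e w) a∈S b∉S with a′ ∈? S
  ... | yes a′∈S = crossing-edge S w a′∈S b∉S
  ... | no  a′∉S = a , a′ , a∈S , a′∉S , e

  Spanning : Fin size → Set
  Spanning r = Σ (RootedTree r) λ t → Unique (vertices t) × (∀ u → u ∈ vertices t)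

  private
    length-allFin : length (allFin size) ≡ size
    length-allFin = length-tabulate (λ z → z)

    grow   : ∀ {r} fuel (t : RootedTree r) → Unique (vertices t) → size ≤ fuel + length (vertices t) → Spanning r
    extend : ∀ {r} fuel (t : RootedTree r) → Unique (vertices t) → size ≤ fuel + length (vertices t) →
             ∀ u → u ∉ vertices t → Spanning r
    grow fuel t uniq bound with Fin.all? (_∈? vertices t)
    ... | yes all = t , uniq , all
    ... | no ¬all with Fin.¬∀⟶∃¬ size _ (_∈? vertices t) ¬all
    ...   | u , u∉ = extend fuel t uniq bound u u∉
    extend zero t uniq bound u u∉ = ⊥-elim (ℕ.<⇒≱ (subst (length (vertices t) <_) length-allFin
      (Unique-⊆⇒length-≤ (Unique-∷⁺ u∉ uniq) (λ {z} _ → ∈-allFin z))) bound)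
    extend {r} (suc fuel) t uniq bound u u∉
      with crossing-edge (vertices t) (connected r u) (root∈vertices t) u∉
    ... | x , y , x∈ , y∉ , e = grow fuel (attach e t) (Unique-attach e t y∉ uniq) (ℕ.≤-trans bound (begin
          suc fuel + length (vertices t)          ≡⟨ sym (ℕ.+-suc fuel _) ⟩
          fuel + suc (length (vertices t))        ≤⟨ ℕ.+-monoʳ-≤ fuel grows ⟩
          fuel + length (vertices (attach e t))   ∎))
      where
        open ℕ.≤-Reasoning
        grows : suc (length (vertices t)) ≤ length (vertices (attach e t))
        grows = Unique-⊆⇒length-≤ (Unique-∷⁺ y∉ uniq)
                  λ { (here refl) → ∈-attach-new e t x∈ ; (there z∈) → ∈-attach⁺ e t z∈ }

  complete⇒size≤ : ∀ {r} (t : RootedTree r) → (∀ u → u ∈ vertices t) → size ≤ length (vertices t)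
  complete⇒size≤ t complete =
    subst (_≤ length (vertices t)) length-allFin (Unique-⊆⇒length-≤ (allFin⁺ size) (λ {z} _ → complete z))

  spanning-tree : ∀ r → Spanning r
  spanning-tree r = grow size leaf (Unique-∷⁺ (λ ()) []) (ℕ.m≤m+n size 1)

module Tour (n : ℕ) .{{_ : NonZero n}} (T : ReflexiveTree) (vol : VoltageAssignment T n)
            (loops-units : ∀ u → Coprime ∣ VoltageAssignment.loopV vol u ∣ n)
            (c ω : ℕ) (1≤c : 1 ℕ.≤ c) (c<n : c ℕ.< n)
            (room : ∀ m k → m ℕ.< n → c ℕ.* (n ℕ.∸ m) ℕ.≤ n → k ℕ.* ω ℕ.≤ n → k ℕ.* c ℕ.≤ m) where

  open ReflexiveTree T
  open VoltageAssignment vol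

  open import Data.Nat as ℕ using (ℕ; zero; suc; _≤_; _<_; _∸_; z≤n; s≤s; NonZero)
  open import Data.Integer using (ℤ; +_; _+_; _-_; -_; _*_)
  open import Defs using (Cycle; LiftAdj)

  import Data.Nat.Properties as ℕ
  import Data.Integer.Properties as ℤ
  open import Data.Integer.Tactic.RingSolver using (solve-∀)
  import Data.Nat.Tactic.RingSolver as NatSolver
  open import Data.Bool using (Bool; true; false)
  open import Data.Unit using (⊤; tt)
  open import Data.Fin using (Fin; toℕ; fromℕ<)
  open import Data.List using (List; []; _∷_; _++_; [_]; length)
  open import Data.List.Properties using (length-++)
  open import Data.List.Membership.Propositional using (_∈_; _∉_)
  open import Data.List.Membership.Propositional.Properties using (∈-++⁺ˡ; ∈-++⁺ʳ; ∈-++⁻)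
  open import Data.List.Relation.Unary.Any using (here; there)
  open import Data.List.Relation.Unary.AllPairs using ([])
  open import Data.List.Relation.Unary.Unique.Propositional using (Unique)
  open import Data.List.Relation.Unary.Unique.Propositional.Properties using (++⁺)
  open import Data.Product using (Σ; _×_; _,_; proj₁; proj₂)
  open import Data.Sum using (inj₁; inj₂)
  open import Data.Empty using (⊥-elim)
  open import Relation.Binary.PropositionalEquality using (_≡_; _≢_; refl; sym; trans; cong; subst; subst₂)
  open Lists
  open Congruence n
  open Dirichlet n
  open SpanningTree T

  V : Set
  V = Fin size × Fin n

  Lift : V → V → Set
  Lift = LiftAdj T n vol

  step : Fin size → Bool → ℤ
  step v s = signed s (loopV v)

  step-unit : ∀ v s → Coprime ∣ step v s ∣ n
  step-unit v true  = loops-units v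
  step-unit v false = subst (λ a → Coprime a n) (sym (ℤ.∣-i∣≡∣i∣ (loopV v))) (loops-units v)

  private
    reduce-step : ∀ x a → a ≈ + toℕ (reduce (x + a)) - + toℕ (reduce x)
    reduce-step x a = ≈-sym (≈-subst refl (lemma x a) (reduce-difference x (x + a)))
      where lemma : ∀ x a → (x + a) - x ≡ a
            lemma = solve-∀

  loop-step : ∀ v s x → Lift (v , reduce x) (v , reduce (x + step v s))
  loop-step v true  x = inj₂ (refl , inj₁ (≈⇒≡[mod] (reduce-step x (loopV v))))
  loop-step v false x = inj₂ (refl , inj₂ (≈⇒≡[mod] (reduce-step x (- loopV v))))

  edge-up : ∀ {v w} x → Adj v w → Lift (v , reduce x) (w , reduce (x + σ v w))
  edge-up {v} {w} x e = inj₁ (e , ≈⇒≡[mod] (reduce-step x (σ v w)))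

  edge-down : ∀ {v w} x → Adj v w → Lift (w , reduce (x + σ v w)) (v , reduce x)
  edge-down {v} {w} x e = inj₁ (trans (symmetric w v) e , ≈⇒≡[mod] (≈-trans (≡[mod]⇒≈ {σ w v} (antisym v w e))
    (≈-sym (≈-subst refl (lemma x (σ v w)) (reduce-difference (x + σ v w) x)))))
    where lemma : ∀ x a → x - (x + a) ≡ - a
          lemma = solve-∀

  detourAt : ∀ s v w → Detour c (step v s) (loopV w)
  detourAt s v w = detour c (step v s) (loopV w) 1≤c c<n (step-unit v s) (loops-units w)

  fibre : Fin size → ℤ → ℤ → ℕ → List V
  fibre v x h zero    = [ (v , reduce x) ]
  fibre v x h (suc m) = (v , reduce x) ∷ fibre v (x + h) h m

  -- Starting at x in the fibre of v, take m loop steps of the given sign, except that the first steps are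
  -- replaced by detours, one through each child subtree, each re-entering v's fibre offset steps further on.
  tour : ∀ {v} → RootedTree v → ℤ → Bool → ℕ → List V
  tour {v} leaf x s m = fibre v x (step v s) m
  tour {v} (branch {w = w} _ t u) x s m =
    (v , reduce x) ∷ (tour t (x + σ v w) sign steps ++ tour u (x + + offset * step v s) s (m ∸ offset))
    where open Detour (detourAt s v w)

  Sparse : ∀ {v} → RootedTree v → Set
  Sparse leaf              = ⊤
  Sparse t@(branch _ t′ u) = #children t ℕ.* ω ≤ n × Sparse t′ × Sparse u

  root-sparse : ∀ {v} (t : RootedTree v) → Sparse t → #children t ℕ.* ω ≤ n
  root-sparse leaf           _            = z≤n
  root-sparse (branch _ _ _) (bound , _) = bound

  sparse : (∀ u → degree u ℕ.* ω ≤ n) → ∀ {v} (t : RootedTree v) → Unique (vertices t) → Sparse t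
  sparse deg leaf _ = tt
  sparse deg {v} t@(branch _ t′ u) uniq =
    ℕ.≤-trans (ℕ.*-monoˡ-≤ ω (#children≤degree t uniq)) (deg v) ,
    sparse deg t′ (Unique-++⁻ˡ (vertices t′) uniq) , sparse deg u (Unique-++⁻ʳ (vertices t′) uniq)

  child-fits : ∀ s v {w} (t : RootedTree w) → Sparse t → #children t ℕ.* c ≤ Detour.steps (detourAt s v w)
  child-fits s v {w} t sp = room steps (#children t) steps<n few-missed (root-sparse t sp)
    where open Detour (detourAt s v w)

  offset≤budget : ∀ k {j m} → j ≤ c → suc k ℕ.* c ≤ m → j ≤ m
  offset≤budget _ j≤c fits = ℕ.≤-trans j≤c (ℕ.≤-trans (ℕ.m≤m+n _ _) fits)

  rest-fits : ∀ k {j m} → j ≤ c → suc k ℕ.* c ≤ m → k ℕ.* c ≤ m ∸ j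
  rest-fits k {j} j≤c fits = ℕ.≤-trans (ℕ.≤-trans (ℕ.m≤n+m (k ℕ.* c) (c ∸ j))
    (ℕ.≤-reflexive (sym (ℕ.+-∸-comm _ j≤c)))) (ℕ.∸-monoˡ-≤ j fits)

  private
    shift : ∀ x h (i : ℕ) → x + h + + i * h ≡ x + + suc i * h
    shift x h i = lemma x h (+ i)
      where lemma : ∀ x h i → x + h + i * h ≡ x + (+ 1 + i) * h
            lemma = solve-∀

    shift-by : ∀ x h (j i : ℕ) → x + + j * h + + i * h ≡ x + + (j ℕ.+ i) * h
    shift-by x h j i = trans (lemma x (+ j) (+ i) h) (cong (λ k → x + k * h) (sym (ℤ.pos-+ j i)))
      where lemma : ∀ x j i h → x + j * h + i * h ≡ x + (j + i) * h
            lemma = solve-∀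

    retarget : ∀ {a xs v y y′} → y ≡ y′ → Chain Lift a xs (v , reduce y) → Chain Lift a xs (v , reduce y′)
    retarget refl p = p

  fibre-chain : ∀ v x s m → Chain Lift (v , reduce x) (fibre v x (step v s) m) (v , reduce (x + + m * step v s))
  fibre-chain v x s zero    = retarget (sym (ℤ.+-identityʳ x)) ⟨ _ ⟩
  fibre-chain v x s (suc m) = retarget (shift x (step v s) m)
                                (loop-step v s x ∷ fibre-chain v (x + step v s) s m)

  tour-chain : ∀ {v} (t : RootedTree v) x s m → Sparse t → #children t ℕ.* c ≤ m →
               Chain Lift (v , reduce x) (tour t x s m) (v , reduce (x + + m * step v s))
  tour-chain {v} leaf x s m _ _ = fibre-chain v x s m
  tour-chain {v} (branch {w = w} e t u) x s m (_ , sp-t , sp-u) fits =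
    edge-up x e ∷ Chain-++ (tour-chain t (x + σ v w) sign steps sp-t (child-fits s v t sp-t)) return
                           (retarget spine-end
                             (tour-chain u x′ s (m ∸ offset) sp-u (rest-fits (#children u) offset≤c fits)))
    where
      open Detour (detourAt s v w)
      x′ : ℤ
      x′ = x + + offset * step v s
      return : Lift (w , reduce (x + σ v w + + steps * step w sign)) (v , reduce x′)
      return = subst (λ r → Lift (w , r) (v , reduce x′))
        (reduce-cong (≈-subst (lemma x (σ v w) _) refl (+-cong (≈-reflexive {x + σ v w} refl) (≈-sym closes))))
        (edge-down x′ e)
        where lemma : ∀ x a b → x + a + b ≡ x + b + a
              lemma = solve-∀
      spine-end : x′ + + (m ∸ offset) * step v s ≡ x + + m * step v s
      spine-end = trans (shift-by x (step v s) offset (m ∸ offset))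
                    (cong (λ k → x + + k * step v s) (ℕ.m+[n∸m]≡n (offset≤budget (#children u) offset≤c fits)))

  ∈-fibre : ∀ v x h m {z} → z ∈ fibre v x h m → Σ ℕ λ i → i ≤ m × z ≡ (v , reduce (x + + i * h))
  ∈-fibre v x h zero    (here refl) = 0 , z≤n , cong (λ y → v , reduce y) (sym (ℤ.+-identityʳ x))
  ∈-fibre v x h (suc m) (here refl) = 0 , z≤n , cong (λ y → v , reduce y) (sym (ℤ.+-identityʳ x))
  ∈-fibre v x h (suc m) (there z∈) with ∈-fibre v (x + h) h m z∈
  ... | i , i≤m , refl = suc i , s≤s i≤m , cong (λ y → v , reduce y) (shift x h i)

  ∈-tour⇒∈-vertices : ∀ {v} (t : RootedTree v) x s m {z} → z ∈ tour t x s m → proj₁ z ∈ vertices t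
  ∈-tour⇒∈-vertices {v} leaf x s m z∈ with ∈-fibre v x (step v s) m z∈
  ... | _ , _ , refl = here refl
  ∈-tour⇒∈-vertices t@(branch _ _ _) x s m (here refl) = root∈vertices t
  ∈-tour⇒∈-vertices (branch _ t u) x s m (there z∈) with ∈-++⁻ (tour t _ _ _) z∈
  ... | inj₁ z∈t = ∈-++⁺ˡ (∈-tour⇒∈-vertices t _ _ _ z∈t)
  ... | inj₂ z∈u = ∈-++⁺ʳ (vertices t) (∈-tour⇒∈-vertices u _ _ _ z∈u)

  private
    root∉child : ∀ {v w} (t : RootedTree w) (u : RootedTree v) → Unique (vertices t ++ vertices u) → v ∉ vertices t
    root∉child t u uniq v∈t = Unique-++⁻-disjoint (vertices t) uniq v∈t (root∈vertices u)

  ∈-tour-root-fibre : ∀ {v} (t : RootedTree v) x s m {z} → Unique (vertices t) → #children t ℕ.* c ≤ m →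
                      z ∈ tour t x s m → proj₁ z ≡ v → Σ ℕ λ i → i ≤ m × z ≡ (v , reduce (x + + i * step v s))
  ∈-tour-root-fibre {v} leaf x s m _ _ z∈ _ = ∈-fibre v x (step v s) m z∈
  ∈-tour-root-fibre {v} (branch _ _ _) x s m _ _ (here refl) _ =
    0 , z≤n , cong (λ y → v , reduce y) (sym (ℤ.+-identityʳ x))
  ∈-tour-root-fibre {v} (branch {w = w} _ t u) x s m uniq fits (there z∈) z₁≡v with ∈-++⁻ (tour t _ _ _) z∈
  ... | inj₁ z∈t = ⊥-elim (root∉child t u uniq (subst (_∈ vertices t) z₁≡v (∈-tour⇒∈-vertices t _ _ _ z∈t)))
  ... | inj₂ z∈u = further (∈-tour-root-fibre u _ s (m ∸ offset) (Unique-++⁻ʳ (vertices t) uniq) rest z∈u z₁≡v)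
    where
      open Detour (detourAt s v w)
      rest : #children u ℕ.* c ≤ m ∸ offset
      rest = rest-fits (#children u) offset≤c fits
      further : ∀ {z} → Σ ℕ (λ i → i ≤ m ∸ offset × z ≡ (v , reduce (x + + offset * step v s + + i * step v s))) →
                Σ ℕ λ i → i ≤ m × z ≡ (v , reduce (x + + i * step v s))
      further (i , i≤ , z≡) = offset ℕ.+ i ,
        subst (offset ℕ.+ i ≤_) (ℕ.m+[n∸m]≡n (offset≤budget (#children u) offset≤c fits)) (ℕ.+-monoʳ-≤ offset i≤) ,
        trans z≡ (cong (λ y → v , reduce y) (shift-by x (step v s) offset i))

  reduce-multiple-injective : ∀ {h} → Coprime ∣ h ∣ n → ∀ x k → 1 ≤ k → k < n → reduce x ≢ reduce (x + + k * h)
  reduce-multiple-injective {h} cop x k 1≤k k<n eq = multiple-of-unit≉0 1≤k ℕ.≤-refl k<n cop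
    (≈-subst (lemma x (+ k * h)) (ℤ.+-inverseʳ x)
      (+-cong (≈-sym (reduce-injective {x} {x + + k * h} eq)) (≈-reflexive {a = - x} refl)))
    where lemma : ∀ x a → x + a + - x ≡ a
          lemma = solve-∀

  Unique-fibre : ∀ {h} → Coprime ∣ h ∣ n → ∀ v x m → m < n → Unique (fibre v x h m)
  Unique-fibre cop v x zero    _   = Unique-∷⁺ (λ ()) []
  Unique-fibre {h} cop v x (suc m) m<n =
    Unique-∷⁺ x∉ (Unique-fibre cop v (x + h) m (ℕ.<-trans (ℕ.n<1+n m) m<n))
    where
      x∉ : (v , reduce x) ∉ fibre v (x + h) h m
      x∉ x∈ with ∈-fibre v (x + h) h m x∈
      ... | i , i≤m , eq = reduce-multiple-injective cop x (suc i) (s≤s z≤n) (ℕ.≤-<-trans (s≤s i≤m) m<n)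
                             (trans (cong proj₂ eq) (cong reduce (shift x h i)))

  Unique-tour : ∀ {v} (t : RootedTree v) x s m → Unique (vertices t) → Sparse t → #children t ℕ.* c ≤ m → m < n →
                Unique (tour t x s m)
  Unique-tour {v} leaf x s m _ _ _ m<n = Unique-fibre (step-unit v s) v x m m<n
  Unique-tour {v} (branch {w = w} _ t u) x s m uniq (_ , sp-t , sp-u) fits m<n =
    Unique-∷⁺ x∉ (++⁺ (Unique-tour t _ sign steps uniq-t sp-t (child-fits s v t sp-t) steps<n)
                      (Unique-tour u _ s (m ∸ offset) uniq-u sp-u rest (ℕ.≤-<-trans (ℕ.m∸n≤m m offset) m<n))
                      λ (z∈t , z∈u) → Unique-++⁻-disjoint (vertices t) uniq
                                        (∈-tour⇒∈-vertices t _ _ _ z∈t) (∈-tour⇒∈-vertices u _ _ _ z∈u))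
    where
      open Detour (detourAt s v w)
      uniq-t : Unique (vertices t)
      uniq-t = Unique-++⁻ˡ (vertices t) uniq
      uniq-u : Unique (vertices u)
      uniq-u = Unique-++⁻ʳ (vertices t) uniq
      rest : #children u ℕ.* c ≤ m ∸ offset
      rest = rest-fits (#children u) offset≤c fits
      x∉ : (v , reduce x) ∉ tour t _ sign steps ++ tour u _ s (m ∸ offset)
      x∉ x∈ with ∈-++⁻ (tour t _ _ _) x∈
      ... | inj₁ x∈t = root∉child t u uniq (∈-tour⇒∈-vertices t _ _ _ x∈t)
      ... | inj₂ x∈u with ∈-tour-root-fibre u _ s (m ∸ offset) uniq-u rest x∈u refl
      ...   | i , i≤ , eq = reduce-multiple-injective (step-unit v s) x (offset ℕ.+ i)
                (ℕ.≤-trans 1≤offset (ℕ.m≤m+n offset i))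
                (ℕ.≤-<-trans (subst (offset ℕ.+ i ≤_) (ℕ.m+[n∸m]≡n (offset≤budget (#children u) offset≤c fits))
                                    (ℕ.+-monoʳ-≤ offset i≤)) m<n)
                (trans (cong proj₂ eq) (cong reduce (shift-by x (step v s) offset i)))

  loop-closes : ∀ v → Lift (v , reduce (+ 0 + + (n ∸ 1) * step v true)) (v , reduce (+ 0))
  loop-closes v = subst (λ a → Lift (v , reduce (+ 0 + + (n ∸ 1) * g)) (v , a))
    (reduce-cong (≈-subst (trans (cong (λ k → + 0 + g * + k) (sym (ℕ.m∸n+n≡m (ℕ.>-nonZero⁻¹ n))))
                                 (sym (lemma (+ (n ∸ 1)) g)))
                          refl (+-multiple (+ 0) g)))
    (loop-step v true (+ 0 + + (n ∸ 1) * g))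
    where
      g : ℤ
      g = step v true
      lemma : ∀ m h → + 0 + m * h + h ≡ + 0 + h * (m + + 1)
      lemma = solve-∀

  length-fibre : ∀ v x h m → length (fibre v x h m) ≡ suc m
  length-fibre v x h zero    = refl
  length-fibre v x h (suc m) = cong suc (length-fibre v (x + h) h m)

  private
    detour-cost : ∀ {j m} → j ≤ m → j ≤ c → suc m ≤ suc (suc (m ∸ j)) ℕ.+ (c ∸ 1)
    detour-cost {j} {m} j≤m j≤c = s≤s (begin
      m                          ≡⟨ sym (ℕ.m∸n+n≡m j≤m) ⟩
      m ∸ j ℕ.+ j                ≤⟨ ℕ.+-monoʳ-≤ (m ∸ j) j≤c ⟩
      m ∸ j ℕ.+ c                ≡⟨ cong (m ∸ j ℕ.+_) (sym (ℕ.suc-pred c {{ℕ.>-nonZero 1≤c}})) ⟩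
      m ∸ j ℕ.+ suc (c ∸ 1)      ≡⟨ ℕ.+-suc (m ∸ j) (c ∸ 1) ⟩
      suc (m ∸ j) ℕ.+ (c ∸ 1)    ∎)
      where open ℕ.≤-Reasoning

    spine-step : ∀ W K M M′ e Lt Lu Tt Tu k → M ≤ suc M′ ℕ.+ e → K ℕ.* Lt ≤ W ℕ.* Tt →
                 W ℕ.* M′ ℕ.+ K ℕ.* Lu ≤ W ℕ.* Tu ℕ.+ W ℕ.* (e ℕ.* k) ℕ.+ K →
                 W ℕ.* M ℕ.+ K ℕ.* (Lt ℕ.+ Lu) ≤ W ℕ.* suc (Tt ℕ.+ Tu) ℕ.+ W ℕ.* (e ℕ.* suc k) ℕ.+ K
    spine-step W K M M′ e Lt Lu Tt Tu k M≤ child rest = begin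
      W ℕ.* M ℕ.+ K ℕ.* (Lt ℕ.+ Lu)                                ≤⟨ ℕ.+-monoˡ-≤ _ (ℕ.*-monoʳ-≤ W M≤) ⟩
      W ℕ.* (suc M′ ℕ.+ e) ℕ.+ K ℕ.* (Lt ℕ.+ Lu)                   ≡⟨ lemma₁ W K M′ e Lt Lu ⟩
      (W ℕ.* M′ ℕ.+ K ℕ.* Lu) ℕ.+ K ℕ.* Lt ℕ.+ (W ℕ.+ W ℕ.* e)     ≤⟨ ℕ.+-monoˡ-≤ _ (ℕ.+-mono-≤ rest child) ⟩
      (W ℕ.* Tu ℕ.+ W ℕ.* (e ℕ.* k) ℕ.+ K) ℕ.+ W ℕ.* Tt ℕ.+ (W ℕ.+ W ℕ.* e) ≡⟨ lemma₂ W K e Tt Tu k ⟩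
      W ℕ.* suc (Tt ℕ.+ Tu) ℕ.+ W ℕ.* (e ℕ.* suc k) ℕ.+ K           ∎
      where
        open ℕ.≤-Reasoning
        lemma₁ : ∀ W K M′ e Lt Lu → W ℕ.* (suc M′ ℕ.+ e) ℕ.+ K ℕ.* (Lt ℕ.+ Lu)
                                  ≡ (W ℕ.* M′ ℕ.+ K ℕ.* Lu) ℕ.+ K ℕ.* Lt ℕ.+ (W ℕ.+ W ℕ.* e)
        lemma₁ = NatSolver.solve-∀
        lemma₂ : ∀ W K e Tt Tu k → (W ℕ.* Tu ℕ.+ W ℕ.* (e ℕ.* k) ℕ.+ K) ℕ.+ W ℕ.* Tt ℕ.+ (W ℕ.+ W ℕ.* e)
                                   ≡ W ℕ.* suc (Tt ℕ.+ Tu) ℕ.+ W ℕ.* (e ℕ.* suc k) ℕ.+ K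
        lemma₂ = NatSolver.solve-∀

    leaf-length : ∀ W K M e → W ℕ.* M ℕ.+ K ℕ.* 1 ≡ W ℕ.* M ℕ.+ W ℕ.* (e ℕ.* 0) ℕ.+ K
    leaf-length = NatSolver.solve-∀

    cancel-budget : ∀ {a b p q r} → a ℕ.+ b ≤ p → p ℕ.+ q ≤ r ℕ.+ b ℕ.+ a → q ≤ r
    cancel-budget {a} {b} {p} {q} {r} a+b≤p p+q≤ = ℕ.+-cancelʳ-≤ (a ℕ.+ b) q r (begin
      q ℕ.+ (a ℕ.+ b)  ≤⟨ ℕ.+-monoʳ-≤ q a+b≤p ⟩
      q ℕ.+ p          ≡⟨ ℕ.+-comm q p ⟩
      p ℕ.+ q          ≤⟨ p+q≤ ⟩
      r ℕ.+ b ℕ.+ a    ≡⟨ ℕ.+-assoc r b a ⟩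
      r ℕ.+ (b ℕ.+ a)  ≡⟨ cong (r ℕ.+_) (ℕ.+-comm b a) ⟩
      r ℕ.+ (a ℕ.+ b)  ∎)
      where open ℕ.≤-Reasoning

  -- A vertex whose spine takes m steps and which has k children contributes at least m + 1 − (c − 1) k
  -- vertices to the tour, and node-bound makes every such share worth at least K / W.
  module Length (K : ℕ)
    (node-bound : ∀ m k → m < n → c ℕ.* (n ∸ m) ≤ n → k ℕ.* ω ≤ n →
                  K ℕ.+ c ℕ.* ω ℕ.* ((c ∸ 1) ℕ.* k) ≤ c ℕ.* ω ℕ.* suc m)
    where

    W : ℕ
    W = c ℕ.* ω

    spine-length   : ∀ {v} (t : RootedTree v) x s m → Sparse t → #children t ℕ.* c ≤ m →
                     W ℕ.* suc m ℕ.+ K ℕ.* length (vertices t)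
                       ≤ W ℕ.* length (tour t x s m) ℕ.+ W ℕ.* ((c ∸ 1) ℕ.* #children t) ℕ.+ K
    subtree-length : ∀ {v} (t : RootedTree v) x s m → Sparse t → m < n → c ℕ.* (n ∸ m) ≤ n →
                     K ℕ.* length (vertices t) ≤ W ℕ.* length (tour t x s m)

    spine-length {v} leaf x s m _ _ rewrite length-fibre v x (step v s) m =
      ℕ.≤-reflexive (leaf-length W K (suc m) (c ∸ 1))
    spine-length {v} (branch {w = w} _ t u) x s m (_ , sp-t , sp-u) fits =
      subst₂ (λ L T′ → W ℕ.* suc m ℕ.+ K ℕ.* L ≤ W ℕ.* suc T′ ℕ.+ W ℕ.* ((c ∸ 1) ℕ.* suc (#children u)) ℕ.+ K)
        (sym (length-++ (vertices t))) (sym (length-++ (tour t _ sign steps)))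
        (spine-step W K (suc m) (suc (m ∸ offset)) (c ∸ 1) _ _ _ _ (#children u)
          (detour-cost (offset≤budget (#children u) offset≤c fits) offset≤c)
          (subtree-length t _ sign steps sp-t steps<n few-missed)
          (spine-length u _ s (m ∸ offset) sp-u (rest-fits (#children u) offset≤c fits)))
      where open Detour (detourAt s v w)

    subtree-length t x s m sp m<n few-missed =
      cancel-budget (node-bound m (#children t) m<n few-missed (root-sparse t sp))
                    (spine-length t x s m sp (room m (#children t) m<n few-missed (root-sparse t sp)))

    long-cycle : .{{NonZero ω}} → (∀ u → degree u ℕ.* ω ≤ n) → 3 ℕ.* W ≤ K →
                 Σ (Cycle Lift) λ C → K ℕ.* size ≤ W ℕ.* length (Cycle.vertices C)
    long-cycle deg 3W≤K =
      record { vertices = L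
             ; long     = long
             ; distinct = Unique-tour t (+ 0) true m uniq sp fits m<n
             ; closed   = Chain⇒CyclicallyAdjacent (tour-chain t (+ 0) true m sp fits) (loop-closes r) } ,
      bound
      where
        instance
          size≢0 : NonZero size
          size≢0 = nonempty
          W≢0 : NonZero W
          W≢0 = ℕ.m*n≢0 c ω {{ℕ.>-nonZero 1≤c}}
        r : Fin size
        r = fromℕ< (ℕ.>-nonZero⁻¹ size)
        t : RootedTree r
        t = proj₁ (spanning-tree r)
        uniq : Unique (vertices t)
        uniq = proj₁ (proj₂ (spanning-tree r))
        sp : Sparse t
        sp = sparse deg t uniq
        m : ℕ
        m = n ∸ 1
        1≤n : 1 ≤ n
        1≤n = ℕ.>-nonZero⁻¹ n
        m<n : m < n
        m<n = ℕ.∸-monoʳ-< {n} {1} {0} (s≤s z≤n) 1≤n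
        few-missed : c ℕ.* (n ∸ m) ≤ n
        few-missed = subst (λ k → c ℕ.* k ≤ n) (sym (ℕ.m∸[m∸n]≡n 1≤n))
                       (subst (_≤ n) (sym (ℕ.*-identityʳ c)) (ℕ.<⇒≤ c<n))
        fits : #children t ℕ.* c ≤ m
        fits = room m (#children t) m<n few-missed (root-sparse t sp)
        L : List V
        L = tour t (+ 0) true m
        bound : K ℕ.* size ≤ W ℕ.* length L
        bound = ℕ.≤-trans (ℕ.*-monoʳ-≤ K (complete⇒size≤ t (proj₂ (proj₂ (spanning-tree r)))))
                          (subtree-length t (+ 0) true m sp m<n few-missed)
        long : 3 ≤ length L
        long = ℕ.*-cancelʳ-≤ 3 (length L) W (begin
          3 ℕ.* W        ≤⟨ 3W≤K ⟩
          K              ≤⟨ ℕ.m≤m*n K size ⟩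
          K ℕ.* size     ≤⟨ bound ⟩
          W ℕ.* length L ≡⟨ ℕ.*-comm W (length L) ⟩
          length L ℕ.* W ∎)
          where open ℕ.≤-Reasoning

module Bounds where
  open import Data.Nat as ℕ using (ℕ; zero; suc; _≤_; _<_; z≤n; s≤s; NonZero; _+_; _*_; _∸_)
  import Data.Nat.Properties as ℕ
  open import Data.Nat.Tactic.RingSolver using (solve-∀)
  open import Data.Empty using (⊥-elim)
  open import Data.Bool using (true; false; T)
  open import Defs using (ceilSqrtFrom; ceilSqrt)
  open import Relation.Binary.PropositionalEquality using (_≡_; sym; cong; subst)
  open ℕ.≤-Reasoning

  ω≤ceilSqrtFrom² : ∀ fuel c ω → ω ≤ (c + fuel) * (c + fuel) → ω ≤ ceilSqrtFrom fuel c ω * ceilSqrtFrom fuel c ω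
  ω≤ceilSqrtFrom² zero       c ω ω≤ = subst (λ k → ω ≤ k * k) (ℕ.+-identityʳ c) ω≤
  ω≤ceilSqrtFrom² (suc fuel) c ω ω≤ with ω ℕ.≤ᵇ c * c in eq
  ... | true  = ℕ.≤ᵇ⇒≤ ω (c * c) (subst T (sym eq) _)
  ... | false = ω≤ceilSqrtFrom² fuel (suc c) ω (subst (λ k → ω ≤ k * k) (ℕ.+-suc c fuel) ω≤)

  ω≤ceilSqrt² : ∀ ω → ω ≤ ceilSqrt ω * ceilSqrt ω
  ω≤ceilSqrt² zero    = z≤n
  ω≤ceilSqrt² (suc ω) = ω≤ceilSqrtFrom² (suc ω) 0 (suc ω) (ℕ.m≤m*n (suc ω) (suc ω))

  3≤c : ∀ c ω n .{{_ : NonZero ω}} → c * c * ω + (n * ω + n * c * c) ≤ n * c * ω → ω ≤ c * c → 3 ≤ c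
  3≤c zero ω n _ ω≤0 = ⊥-elim (ℕ.<⇒≱ (ℕ.>-nonZero⁻¹ ω) ω≤0)
  3≤c 1 ω n hyp _ = ⊥-elim (ℕ.<⇒≱ (begin-strict
    n * 1 * ω                         <⟨ ℕ.m<m+n (n * 1 * ω) (ℕ.<-≤-trans (ℕ.>-nonZero⁻¹ ω) (ℕ.m≤m+n ω n)) ⟩
    n * 1 * ω + (ω + n)               ≡⟨ lemma ω n ⟩
    1 * 1 * ω + (n * ω + n * 1 * 1)   ∎) hyp)
    where lemma : ∀ ω n → n * 1 * ω + (ω + n) ≡ 1 * 1 * ω + (n * ω + n * 1 * 1)
          lemma = solve-∀
  3≤c 2 ω n hyp ω≤4 = ⊥-elim (ℕ.<⇒≱ (begin-strict
    n * 2 * ω                         ≡⟨ lemma₁ ω n ⟩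
    n * ω + n * ω                     ≤⟨ ℕ.+-monoʳ-≤ (n * ω) (ℕ.*-monoʳ-≤ n ω≤4) ⟩
    n * ω + n * 4                     <⟨ ℕ.m<m+n _ (ℕ.<-≤-trans (ℕ.>-nonZero⁻¹ ω) (ℕ.m≤n*m ω 4)) ⟩
    n * ω + n * 4 + 4 * ω             ≡⟨ lemma₂ ω n ⟩
    2 * 2 * ω + (n * ω + n * 2 * 2)   ∎) hyp)
    where lemma₁ : ∀ ω n → n * 2 * ω ≡ n * ω + n * ω
          lemma₁ = solve-∀
          lemma₂ : ∀ ω n → n * ω + n * 4 + 4 * ω ≡ 2 * 2 * ω + (n * ω + n * 2 * 2)
          lemma₂ = solve-∀
  3≤c (suc (suc (suc _))) _ _ _ _ = s≤s (s≤s (s≤s z≤n))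

  module Budget (c ω n : ℕ) .{{_ : NonZero c}} .{{_ : NonZero ω}} .{{_ : NonZero n}}
                (hyp : c * c * ω + (n * ω + n * c * c) ≤ n * c * ω) where

    W : ℕ
    W = c * ω

    -- K / W = n (1 − 1/c − c/ω): the number of lift vertices the cycle has to gain per vertex of T.
    K : ℕ
    K = n * c * ω ∸ (n * ω + n * c * c)

    K+loss≡ : K + (n * ω + n * c * c) ≡ n * c * ω
    K+loss≡ = ℕ.m∸n+n≡m (ℕ.≤-trans (ℕ.m≤n+m _ (c * c * ω)) hyp)

    c*c*ω≤K : c * c * ω ≤ K
    c*c*ω≤K = ℕ.+-cancelʳ-≤ (n * ω + n * c * c) (c * c * ω) K
                (subst (c * c * ω + (n * ω + n * c * c) ≤_) (sym K+loss≡) hyp)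

    c<n : c < n
    c<n = ℕ.*-cancelʳ-< W c n (begin-strict
      c * W                                 ≡⟨ lemma₁ c ω ⟩
      c * c * ω                             <⟨ ℕ.m<m+n (c * c * ω) 0<loss ⟩
      c * c * ω + (n * ω + n * c * c)       ≤⟨ hyp ⟩
      n * c * ω                             ≡⟨ lemma₂ n c ω ⟩
      n * W                                 ∎)
      where
        0<loss : 0 < n * ω + n * c * c
        0<loss = ℕ.<-≤-trans (ℕ.>-nonZero⁻¹ (n * ω) {{ℕ.m*n≢0 n ω}}) (ℕ.m≤m+n _ _)
        lemma₁ : ∀ c ω → c * (c * ω) ≡ c * c * ω
        lemma₁ = solve-∀
        lemma₂ : ∀ n c ω → n * c * ω ≡ n * (c * ω)
        lemma₂ = solve-∀

    budget : ∀ m → m < n → c * (n ∸ m) ≤ n → K + n * c * c ≤ W * m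
    budget m m<n few-missed = ℕ.+-cancelʳ-≤ (n * ω) (K + n * c * c) (W * m) (begin
      K + n * c * c + n * ω         ≡⟨ lemma₁ K (n * c * c) (n * ω) ⟩
      K + (n * ω + n * c * c)       ≡⟨ K+loss≡ ⟩
      n * c * ω                     ≡⟨ cong (λ k → k * c * ω) (sym (ℕ.m+[n∸m]≡n (ℕ.<⇒≤ m<n))) ⟩
      (m + (n ∸ m)) * c * ω         ≡⟨ lemma₂ m (n ∸ m) c ω ⟩
      W * m + ω * (c * (n ∸ m))     ≤⟨ ℕ.+-monoʳ-≤ (W * m) (ℕ.*-monoʳ-≤ ω few-missed) ⟩
      W * m + ω * n                 ≡⟨ cong (W * m +_) (ℕ.*-comm ω n) ⟩
      W * m + n * ω                 ∎)
      where
        lemma₁ : ∀ a b d → a + b + d ≡ a + (d + b)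
        lemma₁ = solve-∀
        lemma₂ : ∀ m r c ω → (m + r) * c * ω ≡ c * ω * m + ω * (c * r)
        lemma₂ = solve-∀

    room : ∀ m k → m < n → c * (n ∸ m) ≤ n → k * ω ≤ n → k * c ≤ m
    room m k m<n few-missed kω≤n = ℕ.*-cancelʳ-≤ (k * c) m W {{ℕ.m*n≢0 c ω}} (begin
      k * c * W          ≡⟨ lemma k c ω ⟩
      k * ω * (c * c)    ≤⟨ ℕ.*-monoˡ-≤ (c * c) kω≤n ⟩
      n * (c * c)        ≡⟨ sym (ℕ.*-assoc n c c) ⟩
      n * c * c          ≤⟨ ℕ.m≤n+m (n * c * c) K ⟩
      K + n * c * c      ≤⟨ budget m m<n few-missed ⟩
      W * m              ≡⟨ ℕ.*-comm W m ⟩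
      m * W              ∎)
      where
        lemma : ∀ k c ω → k * c * (c * ω) ≡ k * ω * (c * c)
        lemma = solve-∀

    node-bound : ∀ m k → m < n → c * (n ∸ m) ≤ n → k * ω ≤ n → K + W * ((c ∸ 1) * k) ≤ W * suc m
    node-bound m k m<n few-missed kω≤n = begin
      K + W * ((c ∸ 1) * k)     ≡⟨ cong (K +_) (lemma₁ c ω (c ∸ 1) k) ⟩
      K + c * (c ∸ 1) * (k * ω) ≤⟨ ℕ.+-monoʳ-≤ K (ℕ.*-monoʳ-≤ (c * (c ∸ 1)) kω≤n) ⟩
      K + c * (c ∸ 1) * n       ≤⟨ ℕ.+-monoʳ-≤ K (ℕ.*-monoˡ-≤ n (ℕ.*-monoʳ-≤ c (ℕ.m∸n≤m c 1))) ⟩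
      K + c * c * n             ≡⟨ cong (K +_) (lemma₂ c n) ⟩
      K + n * c * c             ≤⟨ budget m m<n few-missed ⟩
      W * m                     ≤⟨ ℕ.*-monoʳ-≤ W (ℕ.n≤1+n m) ⟩
      W * suc m                 ∎
      where
        lemma₁ : ∀ c ω e k → c * ω * (e * k) ≡ c * e * (k * ω)
        lemma₁ = solve-∀
        lemma₂ : ∀ c n → c * c * n ≡ n * c * c
        lemma₂ = solve-∀

    3W≤K : 3 ≤ c → 3 * W ≤ K
    3W≤K 3≤c = ℕ.≤-trans (ℕ.≤-trans (ℕ.*-monoˡ-≤ W 3≤c) (ℕ.≤-reflexive (sym (ℕ.*-assoc c c ω)))) c*c*ω≤K

module Rationals where
  open import Data.Nat as ℕ using (ℕ; suc; NonZero; _+_; _*_)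
  import Data.Nat.Properties as ℕ
  open import Data.Integer as ℤ using (ℤ; +_; -_)
  import Data.Integer.Properties as ℤ
  open import Data.Integer.Tactic.RingSolver using (solve-∀)
  open import Data.Rational as ℚ using (ℚ; _/_; 1ℚ; toℚᵘ)
  import Data.Rational.Properties as ℚ
  open import Data.Rational.Unnormalised as ℚᵘ using (*≡*; *≤*)
  import Data.Rational.Unnormalised.Properties as ℚᵘ
  open import Relation.Binary.PropositionalEquality using (_≡_; sym; trans; cong; cong₂; subst₂; module ≡-Reasoning)

  /ᵘ-+ : ∀ a d a′ d′ .{{_ : NonZero d}} .{{_ : NonZero d′}} →
         (a ℚᵘ./ d) ℚᵘ.+ (a′ ℚᵘ./ d′) ℚᵘ.≃ ℚᵘ._/_ (a ℤ.* + d′ ℤ.+ a′ ℤ.* + d) (d * d′) {{ℕ.m*n≢0 d d′}}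
  /ᵘ-+ a (suc _) a′ (suc _) = ℚᵘ.≃-refl

  /ᵘ-* : ∀ a d a′ d′ .{{_ : NonZero d}} .{{_ : NonZero d′}} →
         (a ℚᵘ./ d) ℚᵘ.* (a′ ℚᵘ./ d′) ℚᵘ.≃ ℚᵘ._/_ (a ℤ.* a′) (d * d′) {{ℕ.m*n≢0 d d′}}
  /ᵘ-* a (suc _) a′ (suc _) = ℚᵘ.≃-refl

  /ᵘ-≃ : ∀ a d a′ d′ .{{_ : NonZero d}} .{{_ : NonZero d′}} → a ℤ.* + d′ ≡ a′ ℤ.* + d → (a ℚᵘ./ d) ℚᵘ.≃ (a′ ℚᵘ./ d′)
  /ᵘ-≃ a (suc _) a′ (suc _) eq = *≡* eq

  /ᵘ-≤⁻ : ∀ a d a′ d′ .{{_ : NonZero d}} .{{_ : NonZero d′}} → (a ℚᵘ./ d) ℚᵘ.≤ (a′ ℚᵘ./ d′) → a ℤ.* + d′ ℤ.≤ a′ ℤ.* + d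
  /ᵘ-≤⁻ a (suc _) a′ (suc _) (*≤* le) = le

  /ᵘ-≤⁺ : ∀ a d a′ d′ .{{_ : NonZero d}} .{{_ : NonZero d′}} → a ℤ.* + d′ ℤ.≤ a′ ℤ.* + d → (a ℚᵘ./ d) ℚᵘ.≤ (a′ ℚᵘ./ d′)
  /ᵘ-≤⁺ a (suc _) a′ (suc _) le = *≤* le

  -‿/ᵘ : ∀ a d .{{_ : NonZero d}} → ℚᵘ.- (a ℚᵘ./ d) ℚᵘ.≃ (- a) ℚᵘ./ d
  -‿/ᵘ a (suc _) = ℚᵘ.≃-refl

  toℚᵘ-/ : ∀ a d .{{_ : NonZero d}} → toℚᵘ (a / d) ℚᵘ.≃ (a ℚᵘ./ d)
  toℚᵘ-/ a (suc d) = ℚ.toℚᵘ-fromℚᵘ (a ℚᵘ./ suc d)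

  ≤/⇒*≤ : ∀ k n ω .{{_ : NonZero ω}} → + k / 1 ℚ.≤ + n / ω → k * ω ℕ.≤ n
  ≤/⇒*≤ k n ω le = ℤ.drop‿+≤+ (subst₂ ℤ._≤_ (sym (ℤ.pos-* k ω)) (ℤ.*-identityʳ (+ n))
    (/ᵘ-≤⁻ (+ k) 1 (+ n) ω (ℚᵘ.≤-respʳ-≃ (toℚᵘ-/ (+ n) ω) (ℚᵘ.≤-respˡ-≃ (toℚᵘ-/ (+ k) 1) (ℚ.toℚᵘ-mono-≤ le)))))

  module Ratio (c ω : ℕ) .{{_ : NonZero c}} .{{_ : NonZero ω}} where

    instance
      cω≢0 : NonZero (c * ω)
      cω≢0 = ℕ.m*n≢0 c ω

    -- For c = ceilSqrt ω this is ratio ω.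
    ratio′ : ℚ
    ratio′ = 1ℚ ℚ.- + 1 / c ℚ.- + c / ω

    numerator : ℤ
    numerator = + c ℤ.* + ω ℤ.- + ω ℤ.- + c ℤ.* + c

    private
      instance
        1c≢0 : NonZero (1 * c)
        1c≢0 = ℕ.m*n≢0 1 c
        1cω≢0 : NonZero (1 * c * ω)
        1cω≢0 = ℕ.m*n≢0 (1 * c) ω
        1[cω]≢0 : NonZero (1 * (c * ω))
        1[cω]≢0 = ℕ.m*n≢0 1 (c * ω)

      toℚᵘ-neg/ : ∀ a d .{{_ : NonZero d}} → toℚᵘ (ℚ.- (a / d)) ℚᵘ.≃ (- a) ℚᵘ./ d
      toℚᵘ-neg/ a d = ℚᵘ.≃-trans (ℚ.toℚᵘ-homo‿- (a / d)) (ℚᵘ.≃-trans (ℚᵘ.-‿cong (toℚᵘ-/ a d)) (-‿/ᵘ a d))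

      numerator′ : ℤ
      numerator′ = (+ 1 ℤ.* + c ℤ.+ - + 1 ℤ.* + 1) ℤ.* + ω ℤ.+ - + c ℤ.* + (1 * c)

      numerator′≡ : numerator′ ℤ.* + (c * ω) ≡ numerator ℤ.* + (1 * c * ω)
      numerator′≡ = begin
        numerator′ ℤ.* + (c * ω)
          ≡⟨ cong₂ (λ p q → ((+ 1 ℤ.* + c ℤ.+ - + 1 ℤ.* + 1) ℤ.* + ω ℤ.+ - + c ℤ.* p) ℤ.* q)
                   (ℤ.pos-* 1 c) (ℤ.pos-* c ω) ⟩
        ((+ 1 ℤ.* + c ℤ.+ - + 1 ℤ.* + 1) ℤ.* + ω ℤ.+ - + c ℤ.* (+ 1 ℤ.* + c)) ℤ.* (+ c ℤ.* + ω)
          ≡⟨ lemma (+ c) (+ ω) ⟩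
        numerator ℤ.* (+ 1 ℤ.* + c ℤ.* + ω)
          ≡⟨ cong (numerator ℤ.*_) (sym (trans (ℤ.pos-* (1 * c) ω) (cong (ℤ._* + ω) (ℤ.pos-* 1 c)))) ⟩
        numerator ℤ.* + (1 * c * ω) ∎
        where
          open ≡-Reasoning
          lemma : ∀ c ω → ((+ 1 ℤ.* c ℤ.+ - + 1 ℤ.* + 1) ℤ.* ω ℤ.+ - c ℤ.* (+ 1 ℤ.* c)) ℤ.* (c ℤ.* ω)
                        ≡ (c ℤ.* ω ℤ.- ω ℤ.- c ℤ.* c) ℤ.* (+ 1 ℤ.* c ℤ.* ω)
          lemma = solve-∀

    ratio′≃ : toℚᵘ ratio′ ℚᵘ.≃ numerator ℚᵘ./ (c * ω)
    ratio′≃ = begin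
      toℚᵘ ratio′
        ≈⟨ ℚ.toℚᵘ-homo-+ (1ℚ ℚ.- + 1 / c) (ℚ.- (+ c / ω)) ⟩
      toℚᵘ (1ℚ ℚ.- + 1 / c) ℚᵘ.+ toℚᵘ (ℚ.- (+ c / ω))
        ≈⟨ ℚᵘ.+-cong (ℚᵘ.≃-trans (ℚ.toℚᵘ-homo-+ 1ℚ (ℚ.- (+ 1 / c))) (ℚᵘ.+-cong (toℚᵘ-/ (+ 1) 1) (toℚᵘ-neg/ (+ 1) c)))
                     (toℚᵘ-neg/ (+ c) ω) ⟩
      ((+ 1 ℚᵘ./ 1) ℚᵘ.+ ((- + 1) ℚᵘ./ c)) ℚᵘ.+ ((- + c) ℚᵘ./ ω)
        ≈⟨ ℚᵘ.+-cong (/ᵘ-+ (+ 1) 1 (- + 1) c) ℚᵘ.≃-refl ⟩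
      ((+ 1 ℤ.* + c ℤ.+ - + 1 ℤ.* + 1) ℚᵘ./ (1 * c)) ℚᵘ.+ ((- + c) ℚᵘ./ ω)
        ≈⟨ /ᵘ-+ _ (1 * c) (- + c) ω ⟩
      numerator′ ℚᵘ./ (1 * c * ω)
        ≈⟨ /ᵘ-≃ numerator′ (1 * c * ω) numerator (c * ω) numerator′≡ ⟩
      numerator ℚᵘ./ (c * ω) ∎
      where open ℚᵘ.≃-Reasoning

    scaled≃ : ∀ a → toℚᵘ (+ a / 1 ℚ.* ratio′) ℚᵘ.≃ (+ a ℤ.* numerator) ℚᵘ./ (c * ω)
    scaled≃ a = begin
      toℚᵘ (+ a / 1 ℚ.* ratio′)                          ≈⟨ ℚ.toℚᵘ-homo-* (+ a / 1) ratio′ ⟩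
      toℚᵘ (+ a / 1) ℚᵘ.* toℚᵘ ratio′                     ≈⟨ ℚᵘ.*-cong (toℚᵘ-/ (+ a) 1) ratio′≃ ⟩
      (+ a ℚᵘ./ 1) ℚᵘ.* (numerator ℚᵘ./ (c * ω))        ≈⟨ /ᵘ-* (+ a) 1 numerator (c * ω) ⟩
      (+ a ℤ.* numerator) ℚᵘ./ (1 * (c * ω))
        ≈⟨ /ᵘ-≃ _ (1 * (c * ω)) _ (c * ω)
                (cong ((+ a ℤ.* numerator) ℤ.*_) (cong +_ (sym (ℕ.*-identityˡ (c * ω))))) ⟩
      (+ a ℤ.* numerator) ℚᵘ./ (c * ω)                  ∎
      where open ℚᵘ.≃-Reasoning

    loss : ℕ → ℕ
    loss n = n * ω + n * c * c

    private
      pos-*³ : ∀ a b d → + (a * b * d) ≡ + a ℤ.* + b ℤ.* + d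
      pos-*³ a b d = trans (ℤ.pos-* (a * b) d) (cong (ℤ._* + d) (ℤ.pos-* a b))

      +loss≡ : ∀ n → + loss n ≡ + n ℤ.* + ω ℤ.+ + n ℤ.* + c ℤ.* + c
      +loss≡ n = trans (ℤ.pos-+ (n * ω) _) (cong₂ ℤ._+_ (ℤ.pos-* n ω) (pos-*³ n c c))

    clear-denominators : ∀ n → + c / 1 ℚ.≤ + n / 1 ℚ.* ratio′ → c * c * ω + loss n ℕ.≤ n * c * ω
    clear-denominators n hyp = ℤ.drop‿+≤+ (subst₂ ℤ._≤_ (sym lhs) (sym rhs) (ℤ.+-monoˡ-≤ (+ loss n) cleared))
      where
        cleared : + c ℤ.* + (c * ω) ℤ.≤ (+ n ℤ.* numerator) ℤ.* + 1
        cleared = /ᵘ-≤⁻ (+ c) 1 (+ n ℤ.* numerator) (c * ω)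
                    (ℚᵘ.≤-respʳ-≃ (scaled≃ n) (ℚᵘ.≤-respˡ-≃ (toℚᵘ-/ (+ c) 1) (ℚ.toℚᵘ-mono-≤ hyp)))
        lhs : + (c * c * ω + loss n) ≡ + c ℤ.* + (c * ω) ℤ.+ + loss n
        lhs = trans (ℤ.pos-+ (c * c * ω) (loss n))
                    (cong (ℤ._+ + loss n) (trans (cong +_ (ℕ.*-assoc c c ω)) (ℤ.pos-* c (c * ω))))
        rhs : + (n * c * ω) ≡ (+ n ℤ.* numerator) ℤ.* + 1 ℤ.+ + loss n
        rhs = trans (pos-*³ n c ω)
                    (trans (lemma (+ n) (+ c) (+ ω)) (cong (ℤ._+_ ((+ n ℤ.* numerator) ℤ.* + 1)) (sym (+loss≡ n))))
          where
            lemma : ∀ n c ω → n ℤ.* c ℤ.* ω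
                            ≡ n ℤ.* (c ℤ.* ω ℤ.- ω ℤ.- c ℤ.* c) ℤ.* + 1 ℤ.+ (n ℤ.* ω ℤ.+ n ℤ.* c ℤ.* c)
            lemma = solve-∀

    n*numerator≡ : ∀ n K → K + loss n ≡ n * c * ω → + n ℤ.* numerator ≡ + K
    n*numerator≡ n K eq = begin
      + n ℤ.* numerator                                               ≡⟨ lemma₁ (+ n) (+ c) (+ ω) ⟩
      + n ℤ.* + c ℤ.* + ω ℤ.- (+ n ℤ.* + ω ℤ.+ + n ℤ.* + c ℤ.* + c)    ≡⟨ cong₂ ℤ._-_ (sym (pos-*³ n c ω)) (sym (+loss≡ n)) ⟩
      + (n * c * ω) ℤ.- + loss n                                      ≡⟨ cong (λ k → + k ℤ.- + loss n) (sym eq) ⟩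
      + (K + loss n) ℤ.- + loss n                                     ≡⟨ cong (ℤ._- + loss n) (ℤ.pos-+ K (loss n)) ⟩
      + K ℤ.+ + loss n ℤ.- + loss n                                   ≡⟨ lemma₂ (+ K) (+ loss n) ⟩
      + K                                                             ∎
      where
        open ≡-Reasoning
        lemma₁ : ∀ n c ω → n ℤ.* (c ℤ.* ω ℤ.- ω ℤ.- c ℤ.* c) ≡ n ℤ.* c ℤ.* ω ℤ.- (n ℤ.* ω ℤ.+ n ℤ.* c ℤ.* c)
        lemma₁ = solve-∀
        lemma₂ : ∀ a b → a ℤ.+ b ℤ.- b ≡ a
        lemma₂ = solve-∀

    ratio′*≤ : ∀ n K S L → K + loss n ≡ n * c * ω → K * S ℕ.≤ c * ω * L → ratio′ ℚ.* (+ (S * n) / 1) ℚ.≤ + L / 1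
    ratio′*≤ n K S L eq KS≤ = ℚ.toℚᵘ-cancel-≤ (ℚᵘ.≤-respˡ-≃ (ℚᵘ.≃-sym lhs≃) (ℚᵘ.≤-respʳ-≃ (ℚᵘ.≃-sym (toℚᵘ-/ (+ L) 1))
      (/ᵘ-≤⁺ _ (c * ω) (+ L) 1 (subst₂ ℤ._≤_ (sym lhs) (sym rhs) (ℤ.+≤+ KS≤)))))
      where
        lhs≃ : toℚᵘ (ratio′ ℚ.* (+ (S * n) / 1)) ℚᵘ.≃ (+ (S * n) ℤ.* numerator) ℚᵘ./ (c * ω)
        lhs≃ = ℚᵘ.≃-trans (ℚ.toℚᵘ-cong (ℚ.*-comm ratio′ _)) (scaled≃ (S * n))
        lhs : + (S * n) ℤ.* numerator ℤ.* + 1 ≡ + (K * S)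
        lhs = begin
          + (S * n) ℤ.* numerator ℤ.* + 1       ≡⟨ cong (λ k → k ℤ.* numerator ℤ.* + 1) (ℤ.pos-* S n) ⟩
          + S ℤ.* + n ℤ.* numerator ℤ.* + 1     ≡⟨ lemma (+ S) (+ n) numerator ⟩
          + n ℤ.* numerator ℤ.* + S             ≡⟨ cong (ℤ._* + S) (n*numerator≡ n K eq) ⟩
          + K ℤ.* + S                           ≡⟨ sym (ℤ.pos-* K S) ⟩
          + (K * S)                             ∎
          where
            open ≡-Reasoning
            lemma : ∀ s n r → s ℤ.* n ℤ.* r ℤ.* + 1 ≡ n ℤ.* r ℤ.* s
            lemma = solve-∀
        rhs : + L ℤ.* + (c * ω) ≡ + (c * ω * L)
        rhs = trans (sym (ℤ.pos-* L (c * ω))) (cong +_ (ℕ.*-comm L (c * ω)))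

open import Defs
open import Data.Nat using (ℕ; NonZero; _*_)
open import Data.Nat.Coprimality using (Coprime)
open import Data.Integer using (+_; ∣_∣)
open import Data.Rational using (_≤_; _/_) renaming (_*_ to _*ℚ_)
open import Data.List using (length)
open import Data.Product using (Σ; map₂)
open Bounds
open Rationals

theorem7 : (n ω : ℕ) → .{{_ : NonZero n}} → .{{_ : NonZero ω}} →
    (+ ceilSqrt ω) / 1 ≤ ((+ n) / 1) *ℚ ratio ω →
    (T : ReflexiveTree) →
    (∀ u → (+ ReflexiveTree.degree T u) / 1 ≤ (+ n) / ω) →
    (vol : VoltageAssignment T n) →
    (∀ u → Coprime ∣ VoltageAssignment.loopV vol u ∣ n) →
    Σ (Cycle (LiftAdj T n vol)) (λ C →
      ratio ω *ℚ ((+ (ReflexiveTree.size T * n)) / 1)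
        ≤ (+ length (Cycle.vertices C)) / 1)
theorem7 n ω hyp T deg vol loops-units =
  map₂ (ratio′*≤ n K (ReflexiveTree.size T) _ K+loss≡)
       (long-cycle degree-bound (3W≤K (3≤c c ω n hyp′ (ω≤ceilSqrt² ω))))
  where
    c : ℕ
    c = ceilSqrt ω
    instance
      c≢0 : NonZero c
      c≢0 = ceilSqrt-nonZero ω
    open Ratio c ω using (loss; clear-denominators; ratio′*≤)
    hyp′ : c * c * ω ℕ.+ loss n ℕ.≤ n * c * ω
    hyp′ = clear-denominators n hyp
    open Budget c ω n hyp′
    open Tour n T vol loops-units c ω (ℕ.>-nonZero⁻¹ c) c<n room using (module Length)
    open Length K node-bound using (long-cycle)
    degree-bound : ∀ u → ReflexiveTree.degree T u * ω ℕ.≤ n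
    degree-bound u = ≤/⇒*≤ (ReflexiveTree.degree T u) n ω (deg u)
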